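{- Let $T$ be a finite tree with $m\ge 3$ leaves, and let $T'$ be the subgraph of $T$ induced by the non-leaf vertices. If $\Delta(T)=m$, then $\chi'_L(T)=m$. If $\Delta(T)<m$, then $\chi'_L(T)\le \Delta(T')+m$.
   Context: A leaf is a vertex of degree $1$; $\Delta(\cdot)$ is the maximum degree. For a proper edge coloring $c:E(G)\to\{1,\dots,k\}$ of a connected graph $G$, let $\pi=(\mathcal{C}_1,\dots,\mathcal{C}_k)$ be the ordered partition of $E(G)$ into color classes. For a vertex $v$ and an edge $e=xy$, $d(v,e)=\min\{d(v,x),d(v,y)\}$, and $d(v,\mathcal{C}_i)=\min\{d(v,e): e\in\mathcal{C}_i\}$. The edge color code of $v$ is $c_\pi(v)=(d(v,\mathcal{C}_1),\dots,d(v,\mathcal{C}_k))$. The coloring is an edge-locating coloring if distinct vertices have distinct edge color codes; $\chi'_L(G)$ is the minimum number of colors in an edge-locating coloring of $G$. -}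

module Defs where

open import Data.Nat using (ℕ; zero; suc; _+_; _≤_; _<_; _⊔_)
open import Data.Bool using (Bool; true; false; T)
open import Data.Fin using (Fin; inject₁; fromℕ)
import Data.Fin as F
open import Data.Fin.Subset using (Subset; ∣_∣)
open import Data.Vec using (tabulate)
open import Data.List using (List; foldr; filter; length)
open import Data.List.Base using (allFin)
open import Data.Product using (Σ; ∃; _×_; _,_)
open import Data.Sum using (_⊎_)
open import Relation.Nullary using (¬_)
open import Relation.Unary using (Decidable)
open import Relation.Binary.PropositionalEquality using (_≡_; _≢_)
open import Function.Definitions using (Injective)
open import Data.Nat using (_≟_)
open import Relation.Nullary.Decidable using (T?; ¬?)

record Graph : Set where
  field
    n       : ℕ
    adj     : Fin n → Fin n → Bool
    adj-sym : ∀ u v → adj u v ≡ adj v u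
    irrefl  : ∀ v → adj v v ≡ false
open Graph public

Adj : (G : Graph) → Fin (n G) → Fin (n G) → Set
Adj G u v = T (adj G u v)

data Walk (G : Graph) : Fin (n G) → Fin (n G) → ℕ → Set where
  here : ∀ {u} → Walk G u u 0
  step : ∀ {u w v k} → Adj G u w → Walk G w v k → Walk G u v (suc k)

Connected : Graph → Set
Connected G = ∀ u v → ∃ λ k → Walk G u v k

HasCycle : Graph → Set
HasCycle G = Σ ℕ λ k → Σ (Fin (suc (suc (suc k))) → Fin (n G)) λ f →
  Injective _≡_ _≡_ f
  × (∀ (i : Fin (suc (suc k))) → Adj G (f (inject₁ i)) (f (F.suc i)))
  × Adj G (f (fromℕ (suc (suc k)))) (f F.zero)

IsTree : Graph → Set
IsTree G = Connected G × ¬ HasCycle G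

deg : (G : Graph) → Fin (n G) → ℕ
deg G v = ∣ tabulate (adj G v) ∣

IsLeaf : (G : Graph) → Fin (n G) → Set
IsLeaf G v = deg G v ≡ 1

leaves : (G : Graph) → List (Fin (n G))
leaves G = filter (λ v → deg G v ≟ 1) (allFin (n G))

numLeaves : Graph → ℕ
numLeaves G = length (leaves G)

maxList : List ℕ → ℕ
maxList = foldr _⊔_ 0

Δ : Graph → ℕ
Δ G = maxList (Data.List.map (deg G) (allFin (n G)))

nonLeaves : (G : Graph) → List (Fin (n G))
nonLeaves G = filter (λ v → ¬? (deg G v ≟ 1)) (allFin (n G))

-- degree of a non-leaf vertex v in T' (subgraph induced by non-leaf vertices):
-- the number of non-leaf neighbours of v.
degInner : (G : Graph) → Fin (n G) → ℕ
degInner G v = length (filter (λ w → T? (adj G v w)) (nonLeaves G))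

ΔInner : Graph → ℕ
ΔInner G = maxList (Data.List.map (degInner G) (nonLeaves G))

-- Edge colourings with k colours: c is defined on ordered pairs, required to be
-- symmetric on edges (so it is a function on edges); its values on non-edges are irrelevant.
record EdgeColoring (G : Graph) (k : ℕ) : Set where
  field
    col       : Fin (n G) → Fin (n G) → Fin k
    col-sym   : ∀ u v → Adj G u v → col u v ≡ col v u
    proper    : ∀ u v w → Adj G u v → Adj G u w → v ≢ w → col u v ≢ col u w
    -- every colour class is nonempty (ordered partition into k classes)
    surj      : ∀ (i : Fin k) → Σ (Fin (n G)) λ x → Σ (Fin (n G)) λ y → Adj G x y × col x y ≡ i
open EdgeColoring public

-- DistToClass G c v i d : d(v, C_i) = d, i.e. d is the minimum of d(v,x) over
-- endpoints x of edges xy of colour i (d(v,x) being the length of a shortest walk).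
DistToClass : (G : Graph) {k : ℕ} → EdgeColoring G k → Fin (n G) → Fin k → ℕ → Set
DistToClass G c v i d =
  (Σ (Fin (n G)) λ x → Σ (Fin (n G)) λ y → Adj G x y × col c x y ≡ i × Walk G v x d)
  × (∀ x y d' → Adj G x y → col c x y ≡ i → Walk G v x d' → d ≤ d')

IsEdgeLocating : (G : Graph) {k : ℕ} → EdgeColoring G k → Set
IsEdgeLocating G c = ∀ u v → u ≢ v →
  Σ _ λ i → Σ ℕ λ d₁ → Σ ℕ λ d₂ →
    DistToClass G c u i d₁ × DistToClass G c v i d₂ × d₁ ≢ d₂

HasELC : Graph → ℕ → Set
HasELC G k = Σ (EdgeColoring G k) λ c → IsEdgeLocating G c

ChiL≡ : Graph → ℕ → Set
ChiL≡ G m = HasELC G m × (∀ k → k < m → ¬ HasELC G k)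

ChiL≤ : Graph → ℕ → Set
ChiL≤ G N = Σ ℕ λ k → k ≤ N × HasELC G k

-- If Δ(T) = m, the tree is a spider: every leg leaving a vertex r of degree m ends in a leaf, so any
-- further branching would produce an (m+1)-st leaf. Colour the edges of leg i alternately i, i + 1, i, …
-- (mod m) starting at r. A vertex on leg i only meets the colours i and i + 1 before it reaches r, so
-- its distance to any other class is exactly its depth; as m ≥ 3 this separates vertices of different
-- depth, and at equal depth the alternation separates different legs. Fewer than m colours cannot
-- even colour the edges at r properly.
--
-- In general, root the tree at an inner vertex r of maximal inner degree Δ(T'), colour the inner edges
-- top-down with Δ(T') colours (each vertex hands its children the colours other than that of the edge to
-- its parent) and give each of the m pendant edges a colour of its own. Given x ≠ y, take a leaf z
-- below y in the tree rooted at x: the pendant class of z is strictly closer to y than to x unless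
-- y = z is a leaf adjacent to x, and two adjacent leaves cannot coexist with m ≥ 3 leaves.
module Submission where

open import Defs
open import Data.Nat using (ℕ; zero; suc; _≤_; _<_; _+_; _∸_; z≤n; s≤s; s≤s⁻¹; _≤?_; _<?_; _≟_; z<s)
open import Data.Nat.Properties
open import Data.Product using (_×_; Σ; ∃; _,_; proj₁; proj₂)
open import Data.Sum using (_⊎_; inj₁; inj₂)
import Data.Sum as Sum
open import Data.Empty using (⊥; ⊥-elim)
open import Data.Bool using (Bool; true; false; T)
open import Data.Fin using (Fin; toℕ; fromℕ<; inject₁; fromℕ)
import Data.Fin as F
import Data.Fin.Properties as FP
open import Data.List using (List; []; _∷_; length; filter; lookup; allFin)
import Data.List as L
open import Data.List.Membership.Propositional using (_∈_)
open import Data.List.Membership.Propositional.Properties using (∈-filter⁺; ∈-filter⁻; ∈-allFin; ∈-lookup)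
open import Data.List.Relation.Unary.Any using (here; there)
open import Data.List.Relation.Unary.All using (_∷_)
import Data.List.Relation.Unary.All as All
open import Data.List.Relation.Unary.Unique.Propositional using (Unique)
import Data.List.Relation.Unary.Unique.Propositional.Properties as Unique
open import Data.List.Relation.Unary.AllPairs using ([]; _∷_)
import Data.Vec as Vec
open import Relation.Nullary using (¬_; Dec; yes; no)
open import Relation.Nullary.Decidable using (T?; ¬?; _×-dec_; _⊎-dec_)
open import Relation.Unary using (Decidable)
open import Relation.Binary.PropositionalEquality using (_≡_; _≢_; refl; sym; trans; cong; cong₂; subst; subst₂; module ≡-Reasoning)
open import Function.Definitions using (Injective)
open import Function using (_∘′_)
open import Relation.Binary.Definitions using (Tri; tri<; tri≈; tri>; DecidableEquality)

module _ {P : ℕ → Set} (P? : Decidable P) where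
  private
    search : ∀ b → (∀ d → d < b → ¬ P d) ⊎ Σ ℕ (λ d → P d × (∀ d' → d' < d → ¬ P d'))
    search zero = inj₁ λ _ ()
    search (suc b) with search b
    ... | inj₂ found = inj₂ found
    ... | inj₁ none with P? b
    ...   | yes pb = inj₂ (b , pb , none)
    ...   | no ¬pb = inj₁ λ d d<1+b → Sum.[ none d , (λ { refl → ¬pb }) ] (m<1+n⇒m<n∨m≡n d<1+b)

  least : ∀ {k} → P k → Σ ℕ λ d → P d × (∀ {d'} → P d' → d ≤ d')
  least {k} pk with search (suc k)
  ... | inj₁ none = ⊥-elim (none k ≤-refl pk)
  ... | inj₂ (d , pd , below) = d , pd , λ pd' → ≮⇒≥ λ d'<d → below _ d'<d pd'

module Walks (G : Graph) where
  V : Set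
  V = Fin (n G)

  Adj? : ∀ u v → Dec (Adj G u v)
  Adj? u v = T? (adj G u v)

  Adj-sym : ∀ {u v} → Adj G u v → Adj G v u
  Adj-sym {u} {v} = subst T (adj-sym G u v)

  Adj-irrefl : ∀ {u} → ¬ Adj G u u
  Adj-irrefl {u} = subst T (irrefl G u)

  Adj⇒≢ : ∀ {u v} → Adj G u v → u ≢ v
  Adj⇒≢ a refl = Adj-irrefl a

  snoc : ∀ {u v w k} → Walk G u v k → Adj G v w → Walk G u w (suc k)
  snoc here e = step e here
  snoc (step a p) e = step a (snoc p e)

  reverse : ∀ {u v k} → Walk G u v k → Walk G v u k
  reverse here = here
  reverse (step a p) = snoc (reverse p) (Adj-sym a)

  _++ᵂ_ : ∀ {u v w a b} → Walk G u v a → Walk G v w b → Walk G u w (a + b)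
  here ++ᵂ q = q
  step e p ++ᵂ q = step e (p ++ᵂ q)

  unsnoc : ∀ {u v k} → Walk G u v (suc k) → Σ V λ w → Walk G u w k × Adj G w v
  unsnoc (step e here) = _ , here , e
  unsnoc (step e (step e' p)) with unsnoc (step e' p)
  ... | w , q , a = w , step e q , a

  walk₀⇒≡ : ∀ {u v} → Walk G u v 0 → u ≡ v
  walk₀⇒≡ here = refl

  Walk? : ∀ k u v → Dec (Walk G u v k)
  Walk? zero u v with u FP.≟ v
  ... | yes refl = yes here
  ... | no u≢v = no λ w → u≢v (walk₀⇒≡ w)
  Walk? (suc k) u v with FP.any? (λ w → Adj? u w ×-dec Walk? k w v)
  ... | yes (w , a , p) = yes (step a p)
  ... | no none = no λ { (step {w = w} a p) → none (w , a , p) }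

  vertexAt : ∀ {u v k} → Walk G u v k → ℕ → V
  vertexAt {u} here _ = u
  vertexAt {u} (step _ _) zero = u
  vertexAt (step _ p) (suc i) = vertexAt p i

  vertexAt-start : ∀ {u v k} (p : Walk G u v k) → vertexAt p 0 ≡ u
  vertexAt-start here = refl
  vertexAt-start (step _ _) = refl

  vertexAt-end : ∀ {u v k} (p : Walk G u v k) → vertexAt p k ≡ v
  vertexAt-end here = refl
  vertexAt-end (step _ p) = vertexAt-end p

  vertexAt-Adj : ∀ {u v k} (p : Walk G u v k) → ∀ i → i < k → Adj G (vertexAt p i) (vertexAt p (suc i))
  vertexAt-Adj (step a p) zero _ = subst (Adj G _) (sym (vertexAt-start p)) a
  vertexAt-Adj (step a p) (suc i) i<k = vertexAt-Adj p i (s≤s⁻¹ i<k)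

  prefix : ∀ {u v k} (p : Walk G u v k) → ∀ i → i ≤ k → Walk G u (vertexAt p i) i
  prefix here zero _ = here
  prefix (step a p) zero _ = here
  prefix (step a p) (suc i) i≤k = step a (prefix p i (s≤s⁻¹ i≤k))

  suffix : ∀ {u v k} (p : Walk G u v k) → ∀ i → i ≤ k → Walk G (vertexAt p i) v (k ∸ i)
  suffix here zero _ = here
  suffix (step a p) zero _ = step a p
  suffix (step a p) (suc i) i≤k = suffix p i (s≤s⁻¹ i≤k)

module Distance (G : Graph) (conn : Connected G) where
  open Walks G

  abstract
    shortestWalk : ∀ u v → Σ ℕ λ k → Walk G u v k × (∀ {k'} → Walk G u v k' → k ≤ k')
    shortestWalk u v = least (λ k → Walk? k u v) (proj₂ (conn u v))

    dist : V → V → ℕ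
    dist u v = proj₁ (shortestWalk u v)

    dist-walk : ∀ u v → Walk G u v (dist u v)
    dist-walk u v = proj₁ (proj₂ (shortestWalk u v))

    dist-minimal : ∀ {u v k} → Walk G u v k → dist u v ≤ k
    dist-minimal {u} {v} = proj₂ (proj₂ (shortestWalk u v))

  dist-step : ∀ {u v w} → Adj G v w → dist u w ≤ suc (dist u v)
  dist-step {u} {v} e = dist-minimal (snoc (dist-walk u v) e)

  dist≡0⇒≡ : ∀ {u v} → dist u v ≡ 0 → u ≡ v
  dist≡0⇒≡ {u} {v} eq = walk₀⇒≡ (subst (Walk G u v) eq (dist-walk u v))

  dist-refl : ∀ u → dist u u ≡ 0
  dist-refl u = n≤0⇒n≡0 (dist-minimal here)

  module Separation {k} (c : EdgeColoring G k) where
    distToClass : ∀ v i → ∃ (DistToClass G c v i)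
    distToClass v i with surj c i
    ... | x , y , x~y , cxy≡i with least reachesClass? (x , y , x~y , cxy≡i , proj₂ (conn v x))
      where
        reachesClass? : ∀ d → Dec (Σ V λ x → Σ V λ y → Adj G x y × col c x y ≡ i × Walk G v x d)
        reachesClass? d = FP.any? λ x → FP.any? λ y → Adj? x y ×-dec (col c x y FP.≟ i) ×-dec Walk? d v x
    ... | d , reach , minimal = d , reach , λ x y d' x~y cxy≡i p → minimal (x , y , x~y , cxy≡i , p)

    incident⇒distToClass≡0 : ∀ {x b i} → Adj G x b → col c x b ≡ i → DistToClass G c x i 0
    incident⇒distToClass≡0 {b = b} x~b xb∈i = (_ , b , x~b , xb∈i , here) , λ _ _ _ _ _ _ → z≤n

    Separates : V → V → Set
    Separates u v = Σ (Fin k) λ i → Σ ℕ λ d₁ → Σ ℕ λ d₂ →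
                    DistToClass G c u i d₁ × DistToClass G c v i d₂ × d₁ ≢ d₂

    Separates-sym : ∀ {u v} → Separates u v → Separates v u
    Separates-sym (i , d₁ , d₂ , u→i , v→i , d₁≢d₂) = i , d₂ , d₁ , v→i , u→i , λ eq → d₁≢d₂ (sym eq)

    separatedBy : ∀ {u v} i → (∀ {d₁ d₂} → DistToClass G c u i d₁ → DistToClass G c v i d₂ → d₁ ≢ d₂) →
                  Separates u v
    separatedBy {u} {v} i differ = i , _ , _ , u→i , v→i , differ u→i v→i
      where
        u→i = proj₂ (distToClass u i)
        v→i = proj₂ (distToClass v i)

module _ {G : Graph} (p q : ℕ → Fin (n G)) (a b : ℕ)
         (p₀≡q₀ : p 0 ≡ q 0)
         (p-Adj : ∀ i → i < suc a → Adj G (p i) (p (suc i)))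
         (q-Adj : ∀ i → i < suc b → Adj G (q i) (q (suc i)))
         (ends-Adj : Adj G (p (suc a)) (q (suc b)))
         (p-inj : ∀ {i j} → i ≤ suc a → j ≤ suc a → p i ≡ p j → i ≡ j)
         (q-inj : ∀ {i j} → i ≤ suc b → j ≤ suc b → q i ≡ q j → i ≡ j)
         (p≢q : ∀ {i j} → i ≤ suc a → 1 ≤ j → j ≤ suc b → p i ≢ q j) where
  open Walks G

  private
    L : ℕ
    L = suc (suc (suc (a + b)))

    -- The cycle runs along p 0, …, p (suc a) and returns along q (suc b), …, q 1.
    vertex : ℕ → V
    vertex t with t ≤? suc a
    ... | yes _ = p t
    ... | no _ = q (suc b ∸ (t ∸ suc (suc a)))

    vertex-p : ∀ {t} → t ≤ suc a → vertex t ≡ p t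
    vertex-p {t} t≤ with t ≤? suc a
    ... | yes _ = refl
    ... | no t≰ = ⊥-elim (t≰ t≤)

    vertex-q : ∀ s → vertex (suc (suc a) + s) ≡ q (suc b ∸ s)
    vertex-q s with suc (suc a) + s ≤? suc a
    ... | yes le = ⊥-elim (<⇒≱ (m≤m+n (suc (suc a)) s) le)
    ... | no _ = cong (λ z → q (suc b ∸ z)) (m+n∸m≡n (suc (suc a)) s)

    data Segment (t : ℕ) : Set where
      onP : t ≤ suc a → Segment t
      onQ : ∀ s → s < suc b → t ≡ suc (suc a) + s → Segment t

    segment : ∀ {t} → t < L → Segment t
    segment {t} t<L with t ≤? suc a
    ... | yes t≤ = onP t≤
    ... | no t≰ = onQ (t ∸ suc (suc a)) s<1+b (sym t≡)
      where
        t≡ : suc (suc a) + (t ∸ suc (suc a)) ≡ t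
        t≡ = m+[n∸m]≡n (≰⇒> t≰)
        s<1+b : t ∸ suc (suc a) < suc b
        s<1+b = +-cancelˡ-< (suc (suc a)) _ _
                  (subst₂ _<_ (sym t≡) (cong (suc ∘′ suc) (sym (+-suc a b))) t<L)

    vertex-inj : ∀ {t t'} → t < L → t' < L → vertex t ≡ vertex t' → t ≡ t'
    vertex-inj t<L t'<L eq with segment t<L | segment t'<L
    ... | onP t≤ | onP t'≤ = p-inj t≤ t'≤ (trans (sym (vertex-p t≤)) (trans eq (vertex-p t'≤)))
    ... | onQ s s< refl | onQ s' s'< refl =
          cong (suc (suc a) +_) (∸-cancelˡ-≡ (<⇒≤ s<) (<⇒≤ s'<)
            (q-inj (m∸n≤m (suc b) s) (m∸n≤m (suc b) s') (trans (sym (vertex-q s)) (trans eq (vertex-q s')))))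
    ... | onP t≤ | onQ s' s'< refl =
          ⊥-elim (p≢q t≤ (m<n⇒0<n∸m s'<) (m∸n≤m (suc b) s') (trans (sym (vertex-p t≤)) (trans eq (vertex-q s'))))
    ... | onQ s s< refl | onP t'≤ =
          ⊥-elim (p≢q t'≤ (m<n⇒0<n∸m s<) (m∸n≤m (suc b) s) (trans (sym (vertex-p t'≤)) (trans (sym eq) (vertex-q s))))

    vertex-Adj : ∀ t → suc t < L → Adj G (vertex t) (vertex (suc t))
    vertex-Adj t 1+t<L with segment 1+t<L
    ... | onP 1+t≤ = subst₂ (Adj G) (sym (vertex-p (m≤n⇒m≤1+n (s≤s⁻¹ 1+t≤)))) (sym (vertex-p 1+t≤)) (p-Adj t 1+t≤)
    ... | onQ zero _ 1+t≡ with suc-injective (trans 1+t≡ (+-identityʳ (suc (suc a))))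
    ...   | refl = subst₂ (Adj G) (sym (vertex-p ≤-refl))
                   (sym (trans (cong vertex (sym (+-identityʳ (suc (suc a))))) (vertex-q 0))) ends-Adj
    vertex-Adj t 1+t<L | onQ (suc s) s< 1+t≡ with suc-injective (trans 1+t≡ (+-suc (suc (suc a)) s))
    ... | refl = subst₂ (Adj G) (trans (cong q (sym (+-∸-assoc 1 (<⇒≤ (s≤s⁻¹ s<))))) (sym (vertex-q s)))
                   (sym (trans (cong vertex (sym (+-suc (suc (suc a)) s))) (vertex-q (suc s))))
                   (Adj-sym (q-Adj (b ∸ s) (s≤s (m∸n≤m b s))))

    vertex-close : Adj G (vertex (suc (suc (a + b)))) (vertex 0)
    vertex-close = subst₂ (Adj G) (sym (trans (vertex-q b) (cong q (m+n∸n≡m 1 b))))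
                     (sym (trans (vertex-p z≤n) p₀≡q₀)) (Adj-sym (q-Adj 0 z<s))

  pathsCycle : HasCycle G
  pathsCycle = a + b , vertex ∘′ toℕ , inj , adjacent , vertex-close′
    where
      inj : Injective _≡_ _≡_ (vertex ∘′ toℕ)
      inj {i} {j} eq = FP.toℕ-injective (vertex-inj (FP.toℕ<n i) (FP.toℕ<n j) eq)
      adjacent : ∀ (i : Fin (suc (suc (a + b)))) → Adj G (vertex (toℕ (inject₁ i))) (vertex (toℕ (F.suc i)))
      adjacent i = subst (λ t → Adj G (vertex t) (vertex (suc (toℕ i)))) (sym (FP.toℕ-inject₁ i))
                     (vertex-Adj (toℕ i) (s≤s (FP.toℕ<n i)))
      vertex-close′ : Adj G (vertex (toℕ (fromℕ (suc (suc (a + b)))))) (vertex 0)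
      vertex-close′ = subst (λ t → Adj G (vertex t) (vertex 0)) (sym (FP.toℕ-fromℕ (suc (suc (a + b))))) vertex-close

lastAgreement : ∀ {N} (p q : ℕ → Fin N) → p 0 ≡ q 0 → ∀ b →
                Σ ℕ λ j → j ≤ b × p j ≡ q j × (∀ {i} → j < i → i ≤ b → p i ≢ q i)
lastAgreement p q p₀≡q₀ zero = 0 , z≤n , p₀≡q₀ , λ 0<i i≤0 → ⊥-elim (<⇒≱ 0<i i≤0)
lastAgreement p q p₀≡q₀ (suc b) with p (suc b) FP.≟ q (suc b)
... | yes agree = suc b , ≤-refl , agree , λ j<i i≤j → ⊥-elim (<⇒≱ j<i i≤j)
... | no differ with lastAgreement p q p₀≡q₀ b
...   | j , j≤b , agree , later = j , m≤n⇒m≤1+n j≤b , agree , λ {i} j<i i≤1+b →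
          Sum.[ (λ i<1+b → later j<i (s≤s⁻¹ i<1+b)) , (λ { refl → differ }) ] (m≤n⇒m<n∨m≡n i≤1+b)

module _ {A : Set} where
  length≡1⇒∈-unique : ∀ {xs : List A} {a b} → length xs ≡ 1 → a ∈ xs → b ∈ xs → a ≡ b
  length≡1⇒∈-unique {x ∷ []} _ (here refl) (here refl) = refl

  length≢1⇒∈-other : ∀ {xs : List A} {a} → DecidableEquality A → Unique xs → a ∈ xs → length xs ≢ 1 →
                     Σ A λ w → w ∈ xs × w ≢ a
  length≢1⇒∈-other {x ∷ []} _ _ _ ≢1 = ⊥-elim (≢1 refl)
  length≢1⇒∈-other {x ∷ y ∷ _} {a} _≟ᴬ_ ((x≢y ∷ _) ∷ _) _ _ with a ≟ᴬ x
  ... | yes refl = y , there (here refl) , λ y≡x → x≢y (sym y≡x)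
  ... | no a≢x = x , here refl , λ x≡a → a≢x (sym x≡a)

  unique-within-pair⇒¬3≤length : ∀ {xs : List A} {a b} → Unique xs →
                                 (∀ {w} → w ∈ xs → w ≡ a ⊎ w ≡ b) → ¬ 3 ≤ length xs
  unique-within-pair⇒¬3≤length {[]} _ _ ()
  unique-within-pair⇒¬3≤length {_ ∷ []} _ _ (s≤s ())
  unique-within-pair⇒¬3≤length {_ ∷ _ ∷ []} _ _ (s≤s (s≤s ()))
  unique-within-pair⇒¬3≤length {p ∷ q ∷ s ∷ _} ((p≢q ∷ p≢s ∷ _) ∷ (q≢s ∷ _) ∷ _) inPair _
    with inPair (here refl) | inPair (there (here refl)) | inPair (there (there (here refl)))
  ... | inj₁ p≡ | inj₁ q≡ | _      = p≢q (trans p≡ (sym q≡))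
  ... | inj₂ p≡ | inj₂ q≡ | _      = p≢q (trans p≡ (sym q≡))
  ... | inj₁ p≡ | inj₂ _  | inj₁ s≡ = p≢s (trans p≡ (sym s≡))
  ... | inj₂ p≡ | inj₁ _  | inj₂ s≡ = p≢s (trans p≡ (sym s≡))
  ... | inj₁ _  | inj₂ q≡ | inj₂ s≡ = q≢s (trans q≡ (sym s≡))
  ... | inj₂ _  | inj₁ q≡ | inj₁ s≡ = q≢s (trans q≡ (sym s≡))

length-filter≡count : ∀ {N} m (h : Fin m → Fin N) (f : Fin N → Bool) →
  length (filter (λ w → T? (f w)) (L.tabulate h)) ≡ Vec.count (Data.Bool._≟ true) (Vec.tabulate (λ i → f (h i)))
length-filter≡count zero h f = refl
length-filter≡count (suc m) h f with f (h F.zero)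
... | true = cong suc (length-filter≡count m (λ i → h (F.suc i)) f)
... | false = length-filter≡count m (λ i → h (F.suc i)) f

position : ∀ {N} → Fin N → List (Fin N) → ℕ
position y [] = 0
position y (z ∷ zs) with y FP.≟ z
... | yes _ = 0
... | no _ = suc (position y zs)

module _ {N : ℕ} where
  position<length : ∀ {y : Fin N} {zs} → y ∈ zs → position y zs < length zs
  position<length {y} {z ∷ zs} y∈ with y FP.≟ z | y∈
  ... | yes _ | _ = z<s
  ... | no y≢z | here y≡z = ⊥-elim (y≢z y≡z)
  ... | no _ | there y∈zs = s≤s (position<length y∈zs)

  position-injective : ∀ {y y' : Fin N} {zs} → y ∈ zs → y' ∈ zs → position y zs ≡ position y' zs → y ≡ y'
  position-injective {y} {y'} {z ∷ zs} y∈ y'∈ eq with y FP.≟ z | y' FP.≟ z | y∈ | y'∈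
  ... | yes refl | yes refl | _ | _ = refl
  ... | yes _ | no _ | _ | _ = ⊥-elim (0≢1+n eq)
  ... | no _ | yes _ | _ | _ = ⊥-elim (0≢1+n (sym eq))
  ... | no y≢z | no _ | here y≡z | _ = ⊥-elim (y≢z y≡z)
  ... | no _ | no y'≢z | there _ | here y'≡z = ⊥-elim (y'≢z y'≡z)
  ... | no _ | no _ | there y∈zs | there y'∈zs = position-injective y∈zs y'∈zs (suc-injective eq)

  position-lookup : ∀ {zs : List (Fin N)} → Unique zs → ∀ i → position (lookup zs i) zs ≡ toℕ i
  position-lookup {z ∷ zs} _ F.zero with z FP.≟ z
  ... | yes _ = refl
  ... | no z≢z = ⊥-elim (z≢z refl)
  position-lookup {z ∷ zs} (z∉zs ∷ u) (F.suc i) with lookup zs i FP.≟ z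
  ... | yes eq = ⊥-elim (All.lookup z∉zs (∈-lookup i) (sym eq))
  ... | no _ = cong suc (position-lookup u i)

  lookup-injective : ∀ {zs : List (Fin N)} → Unique zs → ∀ {i j} → lookup zs i ≡ lookup zs j → i ≡ j
  lookup-injective {zs} u {i} {j} eq =
    FP.toℕ-injective (trans (sym (position-lookup u i)) (trans (cong (λ z → position z zs) eq) (position-lookup u j)))

module Neighbours (G : Graph) where
  open Walks G

  neighbours : V → List V
  neighbours x = filter (λ w → T? (adj G x w)) (allFin (n G))

  neighbours-unique : ∀ x → Unique (neighbours x)
  neighbours-unique x = Unique.filter⁺ _ (Unique.allFin⁺ _)

  Adj⇒∈neighbours : ∀ {x w} → Adj G x w → w ∈ neighbours x
  Adj⇒∈neighbours {x} {w} = ∈-filter⁺ (λ w → T? (adj G x w)) (∈-allFin w)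

  ∈neighbours⇒Adj : ∀ {x w} → w ∈ neighbours x → Adj G x w
  ∈neighbours⇒Adj {x} w∈ = proj₂ (∈-filter⁻ (λ w → T? (adj G x w)) {xs = allFin (n G)} w∈)

  length-neighbours : ∀ x → length (neighbours x) ≡ deg G x
  length-neighbours x = length-filter≡count (n G) (λ i → i) (adj G x)

  leaf-neighbour-unique : ∀ {x a b} → IsLeaf G x → Adj G x a → Adj G x b → a ≡ b
  leaf-neighbour-unique {x} leaf x~a x~b =
    length≡1⇒∈-unique (trans (length-neighbours x) leaf) (Adj⇒∈neighbours x~a) (Adj⇒∈neighbours x~b)

  leaf-neighbour : ∀ {x} → IsLeaf G x → Σ V (Adj G x)
  leaf-neighbour {x} leaf with neighbours x | length-neighbours x | ∈neighbours⇒Adj {x}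
  ... | w ∷ _ | _ | adjacent = w , adjacent (here refl)
  ... | [] | 0≡deg | _ = ⊥-elim (0≢1+n (trans 0≡deg leaf))

  nonLeaf-otherNeighbour : ∀ {x a} → ¬ IsLeaf G x → Adj G x a → Σ V λ w → Adj G x w × w ≢ a
  nonLeaf-otherNeighbour {x} nonLeaf x~a
    with length≢1⇒∈-other FP._≟_ (neighbours-unique x) (Adj⇒∈neighbours x~a)
           (λ ≡1 → nonLeaf (trans (sym (length-neighbours x)) ≡1))
  ... | w , w∈ , w≢a = w , ∈neighbours⇒Adj w∈ , w≢a

  deg≤colours : ∀ {k} → EdgeColoring G k → ∀ v → deg G v ≤ k
  deg≤colours c v with deg G v ≤? _
  ... | yes ≤k = ≤k
  ... | no deg≰k with FP.pigeonhole (subst (_ <_) (sym (length-neighbours v)) (≰⇒> deg≰k))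
                                    (λ i → col c v (lookup (neighbours v) i))
  ...   | i , j , i<j , same = ⊥-elim (proper c v _ _ (∈neighbours⇒Adj (∈-lookup i)) (∈neighbours⇒Adj (∈-lookup j))
                                 (λ eq → <⇒≢ i<j (cong toℕ (lookup-injective (neighbours-unique v) eq))) same)

module RootedTree (G : Graph) (conn : Connected G) (acyc : ¬ HasCycle G) (r : Fin (n G)) where
  open Walks G public
  open Distance G conn public
  open Neighbours G public

  depth : V → ℕ
  depth = dist r

  depth-root : depth r ≡ 0
  depth-root = dist-refl r

  depth≡0⇒≡root : ∀ {x} → depth x ≡ 0 → x ≡ r
  depth≡0⇒≡root d≡0 = sym (dist≡0⇒≡ d≡0)

  depth≡suc⇒≢root : ∀ {x D} → depth x ≡ suc D → x ≢ r
  depth≡suc⇒≢root d≡1+D refl = 0≢1+n (trans (sym depth-root) d≡1+D)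

  ≢root⇒depth≡suc : ∀ {x} → x ≢ r → Σ ℕ λ D → depth x ≡ suc D
  ≢root⇒depth≡suc {x} x≢r with depth x in eq
  ... | zero = ⊥-elim (x≢r (depth≡0⇒≡root eq))
  ... | suc D = D , refl

  <depth⇒≢root : ∀ {x L} → L < depth x → x ≢ r
  <depth⇒≢root L<d refl = n≮0 (subst (_ <_) depth-root L<d)

  ≢root⇒1≤depth : ∀ {x} → x ≢ r → 1 ≤ depth x
  ≢root⇒1≤depth x≢r = n≢0⇒n>0 λ d≡0 → x≢r (depth≡0⇒≡root d≡0)

  record Geodesic (A : ℕ) : Set where
    field
      vertex : ℕ → V
      vertex-0 : vertex 0 ≡ r
      vertex-Adj : ∀ i → i < A → Adj G (vertex i) (vertex (suc i))
      depth-vertex : ∀ i → i ≤ A → depth (vertex i) ≡ i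
  open Geodesic

  geodesicTo : ∀ x → Σ (Geodesic (depth x)) λ γ → vertex γ (depth x) ≡ x
  geodesicTo x = record { vertex = vertexAt w ; vertex-0 = vertexAt-start w ; vertex-Adj = vertexAt-Adj w
                        ; depth-vertex = depth-vertexAt } , vertexAt-end w
    where
      w = dist-walk r x
      depth-vertexAt : ∀ i → i ≤ depth x → depth (vertexAt w i) ≡ i
      depth-vertexAt i i≤ = ≤-antisym (dist-minimal (prefix w i i≤)) (begin
          i                                  ≡⟨ sym (m∸[m∸n]≡n i≤) ⟩
          depth x ∸ (depth x ∸ i)            ≤⟨ ∸-monoˡ-≤ (depth x ∸ i)
                                                           (dist-minimal (dist-walk r (vertexAt w i) ++ᵂ suffix w i i≤)) ⟩
          depth (vertexAt w i) + (depth x ∸ i) ∸ (depth x ∸ i) ≡⟨ m+n∸n≡m (depth (vertexAt w i)) (depth x ∸ i) ⟩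
          depth (vertexAt w i)               ∎)
        where open ≤-Reasoning

  extend : ∀ {A x} (γ : Geodesic A) → Adj G (vertex γ A) x → depth x ≡ suc A →
           Σ (Geodesic (suc A)) λ γ' → vertex γ' A ≡ vertex γ A × vertex γ' (suc A) ≡ x
  extend {A} {x} γ γA~x depth-x = γ' , vertex′-old ≤-refl , vertex′-new
    where
      vertex′ : ℕ → V
      vertex′ i with i ≤? A
      ... | yes _ = vertex γ i
      ... | no _ = x
      vertex′-old : ∀ {i} → i ≤ A → vertex′ i ≡ vertex γ i
      vertex′-old {i} i≤A with i ≤? A
      ... | yes _ = refl
      ... | no i≰A = ⊥-elim (i≰A i≤A)
      vertex′-new : vertex′ (suc A) ≡ x
      vertex′-new with suc A ≤? A
      ... | yes 1+A≤A = ⊥-elim (<-irrefl refl 1+A≤A)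
      ... | no _ = refl
      γ' : Geodesic (suc A)
      γ' = record
        { vertex = vertex′
        ; vertex-0 = trans (vertex′-old z≤n) (vertex-0 γ)
        ; vertex-Adj = λ i i<1+A → Sum.[
            (λ i<A → subst₂ (Adj G) (sym (vertex′-old (<⇒≤ i<A))) (sym (vertex′-old i<A)) (vertex-Adj γ i i<A)) ,
            (λ { refl → subst₂ (Adj G) (sym (vertex′-old ≤-refl)) (sym vertex′-new) γA~x }) ]
            (m<1+n⇒m<n∨m≡n i<1+A)
        ; depth-vertex = λ i i≤1+A → Sum.[
            (λ i<1+A → trans (cong depth (vertex′-old (s≤s⁻¹ i<1+A))) (depth-vertex γ i (s≤s⁻¹ i<1+A))) ,
            (λ { refl → trans (cong depth vertex′-new) depth-x }) ]
            (m≤n⇒m<n∨m≡n i≤1+A)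
        }

  -- Otherwise the two geodesics, from their last common vertex on, close a cycle through the edge.
  geodesics-agree : ∀ {A B} (γ₁ : Geodesic A) (γ₂ : Geodesic B) → B ≤ A →
                    Adj G (vertex γ₁ A) (vertex γ₂ B) → vertex γ₁ B ≡ vertex γ₂ B
  geodesics-agree {A} {B} γ₁ γ₂ B≤A ends-Adj with vertex γ₁ B FP.≟ vertex γ₂ B
  ... | yes agree = agree
  ... | no differ with lastAgreement (vertex γ₁) (vertex γ₂) (trans (vertex-0 γ₁) (sym (vertex-0 γ₂))) B
  ...   | j , j≤B , agree , later = ⊥-elim (acyc (pathsCycle {G = G} p q a b agree p-Adj q-Adj ends-Adj′ p-inj q-inj p≢q))
    where
      j<B : j < B
      j<B = ≤∧≢⇒< j≤B λ { refl → differ agree }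
      j<A = ≤-trans j<B B≤A
      p q : ℕ → V
      p i = vertex γ₁ (i + j)
      q i = vertex γ₂ (i + j)
      a = A ∸ suc j
      b = B ∸ suc j
      end : ∀ {C} → j < C → suc (C ∸ suc j + j) ≡ C
      end {C} j<C = trans (sym (+-suc (C ∸ suc j) j)) (m∸n+n≡m j<C)
      p-bound : ∀ {i} → i ≤ suc a → i + j ≤ A
      p-bound i≤ = ≤-trans (+-monoˡ-≤ _ i≤) (≤-reflexive (end j<A))
      q-bound : ∀ {i} → i ≤ suc b → i + j ≤ B
      q-bound i≤ = ≤-trans (+-monoˡ-≤ _ i≤) (≤-reflexive (end j<B))
      p-Adj : ∀ i → i < suc a → Adj G (p i) (p (suc i))
      p-Adj i i< = vertex-Adj γ₁ (i + j) (p-bound i<)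
      q-Adj : ∀ i → i < suc b → Adj G (q i) (q (suc i))
      q-Adj i i< = vertex-Adj γ₂ (i + j) (q-bound i<)
      ends-Adj′ : Adj G (p (suc a)) (q (suc b))
      ends-Adj′ = subst₂ (Adj G) (cong (vertex γ₁) (sym (end j<A))) (cong (vertex γ₂) (sym (end j<B))) ends-Adj
      depth-p : ∀ {i} → i ≤ suc a → depth (p i) ≡ i + j
      depth-p i≤ = depth-vertex γ₁ _ (p-bound i≤)
      depth-q : ∀ {i} → i ≤ suc b → depth (q i) ≡ i + j
      depth-q i≤ = depth-vertex γ₂ _ (q-bound i≤)
      p-inj : ∀ {i i'} → i ≤ suc a → i' ≤ suc a → p i ≡ p i' → i ≡ i'
      p-inj i≤ i'≤ eq = +-cancelʳ-≡ j _ _ (trans (sym (depth-p i≤)) (trans (cong depth eq) (depth-p i'≤)))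
      q-inj : ∀ {i i'} → i ≤ suc b → i' ≤ suc b → q i ≡ q i' → i ≡ i'
      q-inj i≤ i'≤ eq = +-cancelʳ-≡ j _ _ (trans (sym (depth-q i≤)) (trans (cong depth eq) (depth-q i'≤)))
      p≢q : ∀ {i i'} → i ≤ suc a → 1 ≤ i' → i' ≤ suc b → p i ≢ q i'
      p≢q i≤ 1≤i' i'≤ eq with +-cancelʳ-≡ j _ _ (trans (sym (depth-p i≤)) (trans (cong depth eq) (depth-q i'≤)))
      ... | refl = later (+-monoˡ-≤ j 1≤i') (q-bound i'≤) eq

  Adj⇒depth≢ : ∀ {x y} → Adj G x y → depth x ≢ depth y
  Adj⇒depth≢ {x} {y} x~y d≡ with geodesicTo x | geodesicTo y
  ... | γ₁ , γ₁→x | γ₂ , γ₂→y = Adj⇒≢ x~y (begin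
      x                        ≡⟨ sym γ₁→x ⟩
      vertex γ₁ (depth x)      ≡⟨ cong (vertex γ₁) d≡ ⟩
      vertex γ₁ (depth y)      ≡⟨ geodesics-agree γ₁ γ₂ (≤-reflexive (sym d≡))
                                                     (subst₂ (Adj G) (sym γ₁→x) (sym γ₂→y) x~y) ⟩
      vertex γ₂ (depth y)      ≡⟨ γ₂→y ⟩
      y                        ∎)
    where open ≡-Reasoning

  Adj⇒depth-step : ∀ {x y} → Adj G x y → depth y ≡ suc (depth x) ⊎ depth x ≡ suc (depth y)
  Adj⇒depth-step {x} {y} x~y with <-cmp (depth x) (depth y)
  ... | tri≈ _ d≡ _ = ⊥-elim (Adj⇒depth≢ x~y d≡)
  ... | tri< d< _ _ = inj₁ (≤-antisym (dist-step x~y) d<)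
  ... | tri> _ _ d> = inj₂ (≤-antisym (dist-step (Adj-sym x~y)) d>)

  IsParent : V → V → Set
  IsParent x p = Adj G p x × depth x ≡ suc (depth p)

  parents-unique : ∀ {x p₁ p₂} → IsParent x p₁ → IsParent x p₂ → p₁ ≡ p₂
  parents-unique {x} {p₁} {p₂} (p₁~x , d₁) (p₂~x , d₂) with geodesicTo p₁ | geodesicTo p₂
  ... | γ₁ , γ₁→p₁ | γ₂ , γ₂→p₂ with extend γ₁ (subst (λ z → Adj G z x) (sym γ₁→p₁) p₁~x) d₁
  ...   | γ₁' , γ₁'→p₁ , γ₁'→x = begin
      p₁                         ≡⟨ sym (trans γ₁'→p₁ γ₁→p₁) ⟩
      vertex γ₁' (depth p₁)      ≡⟨ cong (vertex γ₁') (sym d≡) ⟩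
      vertex γ₁' (depth p₂)      ≡⟨ geodesics-agree γ₁' γ₂ (≤-trans (≤-reflexive d≡) (n≤1+n _))
                                      (subst₂ (Adj G) (sym γ₁'→x) (sym γ₂→p₂) (Adj-sym p₂~x)) ⟩
      vertex γ₂ (depth p₂)       ≡⟨ γ₂→p₂ ⟩
      p₂                         ∎
    where
      open ≡-Reasoning
      d≡ : depth p₂ ≡ depth p₁
      d≡ = suc-injective (trans (sym d₂) d₁)

  IsParent? : ∀ x p → Dec (IsParent x p)
  IsParent? x p = Adj? p x ×-dec (depth x ≟ suc (depth p))

  parent-exists : ∀ {x} → x ≢ r → Σ V (IsParent x)
  parent-exists {x} x≢r with ≢root⇒depth≡suc x≢r
  ... | D , d≡ with unsnoc (subst (Walk G r x) d≡ (dist-walk r x))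
  ...   | w , r→w , w~x = w , w~x , trans d≡ (cong suc (≤-antisym D≤ (dist-minimal r→w)))
    where
      D≤ : D ≤ depth w
      D≤ = s≤s⁻¹ (subst (_≤ suc (depth w)) d≡ (dist-step w~x))

  -- parent r = r is a junk value.
  abstract
    parent : V → V
    parent x with FP.any? (IsParent? x)
    ... | yes (p , _) = p
    ... | no _ = x

    parent-isParent : ∀ {x} → x ≢ r → IsParent x (parent x)
    parent-isParent {x} x≢r with FP.any? (IsParent? x)
    ... | yes (_ , isParent) = isParent
    ... | no none = ⊥-elim (none (parent-exists x≢r))

  parent-Adj : ∀ {x} → x ≢ r → Adj G (parent x) x
  parent-Adj x≢r = proj₁ (parent-isParent x≢r)

  depth-parent : ∀ {x} → x ≢ r → depth x ≡ suc (depth (parent x))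
  depth-parent x≢r = proj₂ (parent-isParent x≢r)

  isParent⇒≡parent : ∀ {x p} → IsParent x p → p ≡ parent x
  isParent⇒≡parent isParent@(_ , d≡) = parents-unique isParent (parent-isParent (depth≡suc⇒≢root d≡))

  Adj⇒parent⊎child : ∀ {u v} → Adj G u v →
                     (v ≡ parent u × depth u ≡ suc (depth v)) ⊎ (u ≡ parent v × depth v ≡ suc (depth u))
  Adj⇒parent⊎child u~v with Adj⇒depth-step u~v
  ... | inj₁ d≡ = inj₂ (isParent⇒≡parent (u~v , d≡) , d≡)
  ... | inj₂ d≡ = inj₁ (isParent⇒≡parent (Adj-sym u~v , d≡) , d≡)

  root-child : ∀ {w} → Adj G r w → r ≡ parent w × depth w ≡ suc (depth r)
  root-child r~w = Sum.[ (λ { (_ , d≡) → ⊥-elim (0≢1+n (trans (sym depth-root) d≡)) }) , (λ child → child) ]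
                     (Adj⇒parent⊎child r~w)

  depth<n : ∀ x → depth x < n G
  depth<n x with depth x <? n G
  ... | yes d<n = d<n
  ... | no d≮n with geodesicTo x
  ...   | γ , _ with FP.pigeonhole (s≤s (≮⇒≥ d≮n)) (λ i → vertex γ (toℕ i))
  ...     | i , j , i<j , eq = ⊥-elim (<⇒≢ i<j (trans (sym (depth-vertex γ (toℕ i) (s≤s⁻¹ (FP.toℕ<n i))))
                                         (trans (cong depth eq) (depth-vertex γ (toℕ j) (s≤s⁻¹ (FP.toℕ<n j))))))

  parent^ : ℕ → V → V
  parent^ zero x = x
  parent^ (suc t) x = parent (parent^ t x)

  depth-parent^ : ∀ t z → t ≤ depth z → depth (parent^ t z) + t ≡ depth z
  parent^≢root : ∀ t z → t < depth z → parent^ t z ≢ r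

  depth-parent^ zero z _ = +-identityʳ (depth z)
  depth-parent^ (suc t) z t< = begin
    depth (parent (parent^ t z)) + suc t      ≡⟨ +-suc _ t ⟩
    suc (depth (parent (parent^ t z))) + t    ≡⟨ cong (_+ t) (sym (depth-parent (parent^≢root t z t<))) ⟩
    depth (parent^ t z) + t                   ≡⟨ depth-parent^ t z (<⇒≤ t<) ⟩
    depth z                                   ∎
    where open ≡-Reasoning

  parent^≢root t z t< r≡ = <⇒≢ t< (begin
    t                            ≡⟨ cong (_+ t) (sym (trans (cong depth r≡) depth-root)) ⟩
    depth (parent^ t z) + t      ≡⟨ depth-parent^ t z (<⇒≤ t<) ⟩
    depth z                      ∎)
    where open ≡-Reasoning

  parent^-walk : ∀ t z → t ≤ depth z → Walk G (parent^ t z) z t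
  parent^-walk zero z _ = here
  parent^-walk (suc t) z t< = step (parent-Adj (parent^≢root t z t<)) (parent^-walk t z (<⇒≤ t<))

  record LeafBelow (y : V) : Set where
    field
      leaf : V
      height : ℕ
      isLeaf : IsLeaf G leaf
      depth-leaf : depth leaf ≡ height + depth y
      parent^-leaf : parent^ height leaf ≡ y

  inner-child : ∀ {y} → y ≢ r → ¬ IsLeaf G y → Σ V λ w → IsParent w y
  inner-child y≢r inner with nonLeaf-otherNeighbour inner (Adj-sym (parent-Adj y≢r))
  ... | w , y~w , w≢parent = w , Sum.[ (λ { (w≡parent , _) → ⊥-elim (w≢parent w≡parent) }) ,
                                         (λ { (_ , d≡) → y~w , d≡ }) ]
                                       (Adj⇒parent⊎child y~w)

  leafBelow-parent : ∀ {w y} → IsParent w y → LeafBelow w → LeafBelow y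
  leafBelow-parent {w} {y} w-child@(_ , d≡)
    record { leaf = z ; height = t ; isLeaf = z-leaf ; depth-leaf = d-z ; parent^-leaf = z↑w } =
    record { leaf = z ; height = suc t ; isLeaf = z-leaf
           ; depth-leaf = trans d-z (trans (cong (t +_) d≡) (+-suc t (depth y)))
           ; parent^-leaf = trans (cong parent z↑w) (sym (isParent⇒≡parent w-child)) }

  -- The fuel f bounds the remaining descent, since depths stay below n G.
  leafBelow′ : ∀ f y → y ≢ r → n G ≤ depth y + f → LeafBelow y
  leafBelow′ zero y _ n≤ = ⊥-elim (<⇒≱ (depth<n y) (subst (n G ≤_) (+-identityʳ (depth y)) n≤))
  leafBelow′ (suc f) y y≢r n≤ with deg G y ≟ 1
  ... | yes leaf = record { leaf = y ; height = 0 ; isLeaf = leaf ; depth-leaf = refl ; parent^-leaf = refl }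
  ... | no inner = viaChild (inner-child y≢r inner)
    where
      viaChild : Σ V (λ w → IsParent w y) → LeafBelow y
      viaChild (w , w-child@(_ , d≡)) = leafBelow-parent w-child
        (leafBelow′ f w (depth≡suc⇒≢root d≡) (subst (n G ≤_) (trans (+-suc (depth y) f) (cong (_+ f) (sym d≡))) n≤))

  leafBelow : ∀ y → y ≢ r → LeafBelow y
  leafBelow y y≢r = leafBelow′ (n G) y y≢r (m≤n+m (n G) (depth y))

  parent^-+ : ∀ a b z → parent^ (a + b) z ≡ parent^ a (parent^ b z)
  parent^-+ zero b z = refl
  parent^-+ (suc a) b z = cong parent (parent^-+ a b z)

  ancestor : ℕ → V → V
  ancestor k v = parent^ (depth v ∸ k) v

  ancestor-self : ∀ y → ancestor (depth y) y ≡ y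
  ancestor-self y = cong (λ e → parent^ e y) (n∸n≡0 (depth y))

  ancestor-below : ∀ {t z y} → parent^ t z ≡ y → depth z ≡ t + depth y →
                   ∀ {k} → k ≤ depth y → ancestor k z ≡ ancestor k y
  ancestor-below {t} {z} {y} z↑y depth-z {k} k≤ = begin
    parent^ (depth z ∸ k) z                   ≡⟨ cong (λ e → parent^ e z) steps ⟩
    parent^ ((depth y ∸ k) + t) z             ≡⟨ parent^-+ (depth y ∸ k) t z ⟩
    parent^ (depth y ∸ k) (parent^ t z)       ≡⟨ cong (parent^ (depth y ∸ k)) z↑y ⟩
    parent^ (depth y ∸ k) y                   ∎
    where
      open ≡-Reasoning
      steps : depth z ∸ k ≡ (depth y ∸ k) + t
      steps = trans (cong (_∸ k) depth-z) (trans (+-∸-assoc t k≤) (+-comm t (depth y ∸ k)))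

  ancestor-leafBelow : ∀ {c} (below : LeafBelow c) → ancestor (depth c) (LeafBelow.leaf below) ≡ c
  ancestor-leafBelow {c} below =
    trans (ancestor-below (LeafBelow.parent^-leaf below) (LeafBelow.depth-leaf below) ≤-refl) (ancestor-self c)

  ancestor-parent : ∀ {x k} → x ≢ r → k ≤ depth (parent x) → ancestor k x ≡ ancestor k (parent x)
  ancestor-parent x≢r = ancestor-below {t = 1} refl (depth-parent x≢r)

  deeperEnd : V → V → V
  deeperEnd u v with depth v <? depth u
  ... | yes _ = u
  ... | no _ = v

  deeperEnd-parent : ∀ {u v} → depth u ≡ suc (depth v) → deeperEnd u v ≡ u
  deeperEnd-parent {u} {v} d≡ with depth v <? depth u
  ... | yes _ = refl
  ... | no d≮ = ⊥-elim (d≮ (≤-reflexive (sym d≡)))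

  deeperEnd-child : ∀ {u v} → depth v ≡ suc (depth u) → deeperEnd u v ≡ v
  deeperEnd-child {u} {v} d≡ with depth v <? depth u
  ... | yes d< = ⊥-elim (<-asym d< (≤-reflexive (sym d≡)))
  ... | no _ = refl

  deeperEnd-sym : ∀ {u v} → Adj G u v → deeperEnd u v ≡ deeperEnd v u
  deeperEnd-sym u~v with Adj⇒parent⊎child u~v
  ... | inj₁ (_ , d≡) = trans (deeperEnd-parent d≡) (sym (deeperEnd-child d≡))
  ... | inj₂ (_ , d≡) = trans (deeperEnd-child d≡) (sym (deeperEnd-parent d≡))

module Leaves (G : Graph) where
  open Walks G
  open Neighbours G

  leaves-unique : Unique (leaves G)
  leaves-unique = Unique.filter⁺ _ (Unique.allFin⁺ _)

  IsLeaf⇒∈leaves : ∀ {x} → IsLeaf G x → x ∈ leaves G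
  IsLeaf⇒∈leaves {x} = ∈-filter⁺ (λ v → deg G v ≟ 1) (∈-allFin x)

  ∈leaves⇒IsLeaf : ∀ {x} → x ∈ leaves G → IsLeaf G x
  ∈leaves⇒IsLeaf x∈ = proj₂ (∈-filter⁻ (λ v → deg G v ≟ 1) {xs = allFin (n G)} x∈)

  ¬IsLeaf⇒∈nonLeaves : ∀ {x} → ¬ IsLeaf G x → x ∈ nonLeaves G
  ¬IsLeaf⇒∈nonLeaves {x} = ∈-filter⁺ (λ v → ¬? (deg G v ≟ 1)) (∈-allFin x)

  ∈nonLeaves⇒¬IsLeaf : ∀ {x} → x ∈ nonLeaves G → ¬ IsLeaf G x
  ∈nonLeaves⇒¬IsLeaf x∈ = proj₂ (∈-filter⁻ (λ v → ¬? (deg G v ≟ 1)) {xs = allFin (n G)} x∈)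

  someLeaf : 1 ≤ numLeaves G → Σ V (IsLeaf G)
  someLeaf 1≤ with leaves G | ∈leaves⇒IsLeaf
  ... | x ∷ _ | isLeaf = x , isLeaf (here refl)

  Adj-leaves⇒only-vertices : Connected G → ∀ {x y} → IsLeaf G x → IsLeaf G y → Adj G x y → ∀ w → w ≡ x ⊎ w ≡ y
  Adj-leaves⇒only-vertices conn {x} {y} x-leaf y-leaf x~y w = stay (inj₁ refl) (proj₂ (conn x w))
    where
      stay : ∀ {u v k} → u ≡ x ⊎ u ≡ y → Walk G u v k → v ≡ x ⊎ v ≡ y
      stay u∈ here = u∈
      stay (inj₁ refl) (step x~v p) = stay (inj₂ (leaf-neighbour-unique x-leaf x~v x~y)) p
      stay (inj₂ refl) (step y~v p) = stay (inj₁ (leaf-neighbour-unique y-leaf y~v (Adj-sym x~y))) p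

  ¬Adj-leaves : Connected G → 3 ≤ numLeaves G → ∀ {x y} → IsLeaf G x → IsLeaf G y → ¬ Adj G x y
  ¬Adj-leaves conn three x-leaf y-leaf x~y =
    unique-within-pair⇒¬3≤length leaves-unique (λ {w} _ → Adj-leaves⇒only-vertices conn x-leaf y-leaf x~y w) three

  injection⇒≤numLeaves : ∀ {k} (f : Fin k → V) → (∀ i → IsLeaf G (f i)) → Injective _≡_ _≡_ f → k ≤ numLeaves G
  injection⇒≤numLeaves {k} f f-leaf f-inj with k ≤? numLeaves G
  ... | yes k≤ = k≤
  ... | no k≰ with FP.pigeonhole (≰⇒> k≰) (λ i → fromℕ< (position<length (IsLeaf⇒∈leaves (f-leaf i))))
  ...   | i , j , i<j , same = ⊥-elim (<⇒≢ i<j (cong toℕ (f-inj (position-injective (IsLeaf⇒∈leaves (f-leaf i))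
                                                          (IsLeaf⇒∈leaves (f-leaf j))
            (trans (sym (FP.toℕ-fromℕ< _)) (trans (cong toℕ same) (FP.toℕ-fromℕ< _)))))))

  innerVertex : Connected G → 3 ≤ numLeaves G → Σ V λ v → ¬ IsLeaf G v
  innerVertex conn three with someLeaf (≤-trans (s≤s z≤n) three)
  ... | ℓ , ℓ-leaf with leaf-neighbour ℓ-leaf
  ...   | s , ℓ~s = s , λ s-leaf → ¬Adj-leaves conn three ℓ-leaf s-leaf ℓ~s

≤-maxList : ∀ {A : Set} (f : A → ℕ) {x xs} → x ∈ xs → f x ≤ maxList (L.map f xs)
≤-maxList f {xs = y ∷ ys} (here refl) = m≤m⊔n (f y) _
≤-maxList f {xs = y ∷ ys} (there x∈) = ≤-trans (≤-maxList f x∈) (m≤n⊔m (f y) _)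

maxList-attained : ∀ {A : Set} (f : A → ℕ) {x xs} → x ∈ xs → Σ A λ y → y ∈ xs × f y ≡ maxList (L.map f xs)
maxList-attained f {xs = y ∷ []} _ = y , here refl , sym (⊔-identityʳ (f y))
maxList-attained f {xs = y ∷ z ∷ zs} _ with maxList-attained f {xs = z ∷ zs} (here refl)
    | ⊔-sel (f y) (maxList (L.map f (z ∷ zs)))
... | _ | inj₁ y-max = y , here refl , sym y-max
... | w , w∈ , w-max | inj₂ rest-max = w , there w∈ , trans w-max (sym rest-max)

transpose : ℕ → ℕ → ℕ → ℕ
transpose a b i with i ≟ a | i ≟ b
... | yes _ | _ = b
... | no _ | yes _ = a
... | no _ | no _ = i

data TransposeView (a b i : ℕ) : ℕ → Set where
  at-a : i ≡ a → TransposeView a b i b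
  at-b : i ≢ a → i ≡ b → TransposeView a b i a
  other : i ≢ a → i ≢ b → TransposeView a b i i

transposeView : ∀ a b i → TransposeView a b i (transpose a b i)
transposeView a b i with i ≟ a | i ≟ b
... | yes i≡a | _ = at-a i≡a
... | no i≢a | yes i≡b = at-b i≢a i≡b
... | no i≢a | no i≢b = other i≢a i≢b

transpose-a : ∀ a b → transpose a b a ≡ b
transpose-a a b with transpose a b a | transposeView a b a
... | _ | at-a _ = refl
... | _ | at-b a≢a _ = ⊥-elim (a≢a refl)
... | _ | other a≢a _ = ⊥-elim (a≢a refl)

transpose-b : ∀ a b → transpose a b b ≡ a
transpose-b a b with transpose a b b | transposeView a b b
... | _ | at-a b≡a = b≡a
... | _ | at-b _ _ = refl
... | _ | other _ b≢b = ⊥-elim (b≢b refl)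

transpose-other : ∀ {a b i} → i ≢ a → i ≢ b → transpose a b i ≡ i
transpose-other {a} {b} {i} i≢a i≢b with transpose a b i | transposeView a b i
... | _ | at-a i≡a = ⊥-elim (i≢a i≡a)
... | _ | at-b _ i≡b = ⊥-elim (i≢b i≡b)
... | _ | other _ _ = refl

transpose-involutive : ∀ a b i → transpose a b (transpose a b i) ≡ i
transpose-involutive a b i with transpose a b i | transposeView a b i
... | _ | at-a refl = transpose-b i b
... | _ | at-b _ refl = transpose-a a i
... | _ | other i≢a i≢b = transpose-other i≢a i≢b

transpose-injective : ∀ a b {i j} → transpose a b i ≡ transpose a b j → i ≡ j
transpose-injective a b {i} {j} eq =
  trans (sym (transpose-involutive a b i)) (trans (cong (transpose a b) eq) (transpose-involutive a b j))

transpose-< : ∀ {a b i M} → a < M → b < M → i < M → transpose a b i < M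
transpose-< {a} {b} {i} a<M b<M i<M with transpose a b i | transposeView a b i
... | _ | at-a _ = b<M
... | _ | at-b _ _ = a<M
... | _ | other _ _ = i<M

alternating : ℕ → ℕ → ℕ → ℕ
alternating a b zero = b
alternating a b (suc j) = alternating b a j

alternating-∈ : ∀ a b j → alternating a b j ≡ a ⊎ alternating a b j ≡ b
alternating-∈ a b zero = inj₂ refl
alternating-∈ a b (suc j) = Sum.swap (alternating-∈ b a j)

alternating-step : ∀ {a b} → a ≢ b → ∀ j → alternating a b (suc j) ≢ alternating a b j
alternating-step a≢b zero = a≢b
alternating-step a≢b (suc j) = alternating-step (λ b≡a → a≢b (sym b≡a)) j

alternating-inPhase : ∀ a b a' b' j → (alternating a b j ≡ a × alternating a' b' j ≡ a')
                      ⊎ (alternating a b j ≡ b × alternating a' b' j ≡ b')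
alternating-inPhase a b a' b' zero = inj₂ (refl , refl)
alternating-inPhase a b a' b' (suc j) = Sum.swap (alternating-inPhase b a b' a' j)

-- Colours are computed in ℕ; out of range (only on non-edges) the junk colour 0 is used.
toFin : ∀ {K} → 0 < K → ℕ → Fin K
toFin {K} 0<K k with k <? K
... | yes k<K = fromℕ< k<K
... | no _ = fromℕ< 0<K

toℕ-toFin : ∀ {K} (0<K : 0 < K) {k} → k < K → toℕ (toFin 0<K k) ≡ k
toℕ-toFin {K} _ {k} k<K with k <? K
... | yes k<K' = FP.toℕ-fromℕ< k<K'
... | no k≮K = ⊥-elim (k≮K k<K)

toFin-injective : ∀ {K} (0<K : 0 < K) {k k'} → k < K → k' < K → toFin 0<K k ≡ toFin 0<K k' → k ≡ k'
toFin-injective 0<K k<K k'<K eq = trans (sym (toℕ-toFin 0<K k<K)) (trans (cong toℕ eq) (toℕ-toFin 0<K k'<K))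

toFin-toℕ : ∀ {K} (0<K : 0 < K) (i : Fin K) → toFin 0<K (toℕ i) ≡ i
toFin-toℕ 0<K i = FP.toℕ-injective (toℕ-toFin 0<K (FP.toℕ<n i))

module UpperBound (G : Graph) (conn : Connected G) (acyc : ¬ HasCycle G) (three : 3 ≤ numLeaves G)
                  (r : Fin (n G)) (r-inner : ¬ IsLeaf G r) (degInner-r : degInner G r ≡ ΔInner G) where
  open RootedTree G conn acyc r
  open Leaves G

  m Δ′ : ℕ
  m = numLeaves G
  Δ′ = ΔInner G

  IsLeaf? : ∀ x → Dec (IsLeaf G x)
  IsLeaf? x = deg G x ≟ 1

  innerNeighbours : V → List V
  innerNeighbours x = filter (λ w → T? (adj G x w)) (nonLeaves G)

  innerNeighbours-unique : ∀ x → Unique (innerNeighbours x)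
  innerNeighbours-unique x = Unique.filter⁺ _ (Unique.filter⁺ _ (Unique.allFin⁺ _))

  Adj⇒∈innerNeighbours : ∀ {x w} → Adj G x w → ¬ IsLeaf G w → w ∈ innerNeighbours x
  Adj⇒∈innerNeighbours {x} x~w w-inner = ∈-filter⁺ (λ w → T? (adj G x w)) (¬IsLeaf⇒∈nonLeaves w-inner) x~w

  ∈innerNeighbours⇒ : ∀ {x w} → w ∈ innerNeighbours x → Adj G x w × ¬ IsLeaf G w
  ∈innerNeighbours⇒ {x} w∈ with ∈-filter⁻ (λ w → T? (adj G x w)) {xs = nonLeaves G} w∈
  ... | w∈nonLeaves , x~w = x~w , ∈nonLeaves⇒¬IsLeaf w∈nonLeaves

  parent-inner : ∀ {x} → x ≢ r → ¬ IsLeaf G (parent x)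
  parent-inner {x} x≢r leaf with parent x FP.≟ r
  ... | yes p≡r = r-inner (subst (IsLeaf G) p≡r leaf)
  ... | no p≢r = <⇒≢ (≤-trans (n<1+n _) (n≤1+n _)) depth-x
    where
      x≡grandparent : x ≡ parent (parent x)
      x≡grandparent = leaf-neighbour-unique leaf (parent-Adj x≢r) (Adj-sym (parent-Adj p≢r))
      depth-x : depth x ≡ suc (suc (depth x))
      depth-x = trans (depth-parent x≢r) (cong suc (trans (depth-parent p≢r) (cong (suc ∘′ depth) (sym x≡grandparent))))

  slot : V → V → ℕ
  slot x w = position w (innerNeighbours x)

  slot<Δ′ : ∀ {x w} → ¬ IsLeaf G x → Adj G x w → ¬ IsLeaf G w → slot x w < Δ′
  slot<Δ′ x-inner x~w w-inner = ≤-trans (position<length (Adj⇒∈innerNeighbours x~w w-inner))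
                                        (≤-maxList (degInner G) (¬IsLeaf⇒∈nonLeaves x-inner))

  slot-injective : ∀ {x v w} → Adj G x v → ¬ IsLeaf G v → Adj G x w → ¬ IsLeaf G w → slot x v ≡ slot x w → v ≡ w
  slot-injective x~v v-inner x~w w-inner =
    position-injective (Adj⇒∈innerNeighbours x~v v-inner) (Adj⇒∈innerNeighbours x~w w-inner)

  -- up x is the colour of the edge from x to its parent. The children of the root are coloured by
  -- their slots; elsewhere the transposition sends the parent's slot to up x, which the children avoid.
  childColour : (V → ℕ) → V → V → ℕ
  childColour up x w with x FP.≟ r
  ... | yes _ = slot x w
  ... | no _ = transpose (slot x (parent x)) (up x) (slot x w)

  childColour-root : ∀ {up x} w → x ≡ r → childColour up x w ≡ slot x w
  childColour-root {x = x} w x≡r with x FP.≟ r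
  ... | yes _ = refl
  ... | no x≢r = ⊥-elim (x≢r x≡r)

  childColour-nonroot : ∀ {up x} w → x ≢ r → childColour up x w ≡ transpose (slot x (parent x)) (up x) (slot x w)
  childColour-nonroot {x = x} w x≢r with x FP.≟ r
  ... | yes x≡r = ⊥-elim (x≢r x≡r)
  ... | no _ = refl

  childColour-cong : ∀ {up up' x} w → up x ≡ up' x → childColour up x w ≡ childColour up' x w
  childColour-cong {x = x} w eq with x FP.≟ r
  ... | yes _ = refl
  ... | no _ = cong (λ c → transpose (slot x (parent x)) c (slot x w)) eq

  upColour : ℕ → V → ℕ
  upColour zero _ = 0
  upColour (suc f) u = childColour (upColour f) (parent u) u

  parentColour : V → ℕ
  parentColour u = upColour (depth u) u

  parentColour-unfold : ∀ {u} → u ≢ r → parentColour u ≡ childColour parentColour (parent u) u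
  parentColour-unfold {u} u≢r with ≢root⇒depth≡suc u≢r
  ... | D , d≡ = trans (cong (λ k → upColour k u) d≡)
                       (childColour-cong {upColour D} {parentColour} u
                         (cong (λ k → upColour k (parent u)) (suc-injective (trans (sym d≡) (depth-parent u≢r)))))

  slot-parent<Δ′ : ∀ {u} → u ≢ r → ¬ IsLeaf G u → slot (parent u) u < Δ′
  slot-parent<Δ′ u≢r u-inner = slot<Δ′ (parent-inner u≢r) (parent-Adj u≢r) u-inner

  parentColour<Δ′-at : ∀ D {u} → depth u ≡ suc D → ¬ IsLeaf G u → parentColour u < Δ′
  parentColour<Δ′-at zero {u} d≡ u-inner =
    subst (_< Δ′) (sym (trans (parentColour-unfold u≢r) (childColour-root u parent≡r))) (slot-parent<Δ′ u≢r u-inner)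
    where
      u≢r = depth≡suc⇒≢root d≡
      parent≡r = depth≡0⇒≡root (suc-injective (trans (sym (depth-parent u≢r)) d≡))
  parentColour<Δ′-at (suc D) {u} d≡ u-inner =
    subst (_< Δ′) (sym (trans (parentColour-unfold u≢r) (childColour-nonroot u parent≢r)))
      (transpose-< (slot<Δ′ (parent-inner u≢r) (Adj-sym (parent-Adj parent≢r)) (parent-inner parent≢r))
                   (parentColour<Δ′-at D depth-parent′ (parent-inner u≢r))
                   (slot-parent<Δ′ u≢r u-inner))
    where
      u≢r = depth≡suc⇒≢root d≡
      depth-parent′ = suc-injective (trans (sym (depth-parent u≢r)) d≡)
      parent≢r = depth≡suc⇒≢root depth-parent′

  parentColour<Δ′ : ∀ {u} → u ≢ r → ¬ IsLeaf G u → parentColour u < Δ′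
  parentColour<Δ′ u≢r = parentColour<Δ′-at _ (proj₂ (≢root⇒depth≡suc u≢r))

  innerColour : V → V → ℕ
  innerColour u v = parentColour (deeperEnd u v)

  innerColour<Δ′ : ∀ {u v} → Adj G u v → ¬ IsLeaf G u → ¬ IsLeaf G v → innerColour u v < Δ′
  innerColour<Δ′ u~v u-inner v-inner with Adj⇒parent⊎child u~v
  ... | inj₁ (_ , d≡) = subst (λ z → parentColour z < Δ′) (sym (deeperEnd-parent d≡))
                        (parentColour<Δ′ (depth≡suc⇒≢root d≡) u-inner)
  ... | inj₂ (_ , d≡) = subst (λ z → parentColour z < Δ′) (sym (deeperEnd-child d≡))
                        (parentColour<Δ′ (depth≡suc⇒≢root d≡) v-inner)

  innerColour-child : ∀ {u w} → u ≡ parent w → depth w ≡ suc (depth u) → innerColour u w ≡ childColour parentColour u w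
  innerColour-child {u} {w} u≡parent d≡ = begin
    parentColour (deeperEnd u w)            ≡⟨ cong parentColour (deeperEnd-child d≡) ⟩
    parentColour w                          ≡⟨ parentColour-unfold (depth≡suc⇒≢root d≡) ⟩
    childColour parentColour (parent w) w   ≡⟨ cong (λ z → childColour parentColour z w) (sym u≡parent) ⟩
    childColour parentColour u w            ∎
    where open ≡-Reasoning

  parentColour≢childEdge : ∀ {u w} → u ≢ r → Adj G u w → ¬ IsLeaf G w → u ≡ parent w → depth w ≡ suc (depth u) →
                           parentColour u ≢ innerColour u w
  parentColour≢childEdge {u} {w} u≢r u~w w-inner u≡parent d≡ eq =
    <-asym (≤-reflexive (sym d≡)) (subst (λ z → depth z < depth u) w≡parent depth-parent<)
    where
      q = slot u (parent u)
      slots≡ : transpose q (parentColour u) q ≡ transpose q (parentColour u) (slot u w)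
      slots≡ = trans (transpose-a q (parentColour u))
                     (trans eq (trans (innerColour-child u≡parent d≡) (childColour-nonroot w u≢r)))
      w≡parent : parent u ≡ w
      w≡parent = slot-injective (Adj-sym (parent-Adj u≢r)) (parent-inner u≢r) u~w w-inner (transpose-injective _ _ slots≡)
      depth-parent< : depth (parent u) < depth u
      depth-parent< = ≤-reflexive (sym (depth-parent u≢r))

  innerColour-injective : ∀ {u v w} → Adj G u v → Adj G u w → ¬ IsLeaf G v → ¬ IsLeaf G w →
                          innerColour u v ≡ innerColour u w → v ≡ w
  innerColour-injective {u} {v} {w} u~v u~w v-inner w-inner eq with Adj⇒parent⊎child u~v | Adj⇒parent⊎child u~w
  ... | inj₁ (v≡parent , _) | inj₁ (w≡parent , _) = trans v≡parent (sym w≡parent)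
  ... | inj₁ (_ , d≡) | inj₂ (u≡parent , d≡′) =
        ⊥-elim (parentColour≢childEdge (depth≡suc⇒≢root d≡) u~w w-inner u≡parent d≡′
                  (trans (cong parentColour (sym (deeperEnd-parent d≡))) eq))
  ... | inj₂ (u≡parent , d≡′) | inj₁ (_ , d≡) =
        ⊥-elim (parentColour≢childEdge (depth≡suc⇒≢root d≡) u~v v-inner u≡parent d≡′
                  (trans (cong parentColour (sym (deeperEnd-parent d≡))) (sym eq)))
  ... | inj₂ (u≡parent-v , d≡v) | inj₂ (u≡parent-w , d≡w) = slot-injective u~v v-inner u~w w-inner (slots≡ (u FP.≟ r))
    where
      childColours≡ : childColour parentColour u v ≡ childColour parentColour u w
      childColours≡ = trans (sym (innerColour-child u≡parent-v d≡v)) (trans eq (innerColour-child u≡parent-w d≡w))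
      slots≡ : Dec (u ≡ r) → slot u v ≡ slot u w
      slots≡ (yes u≡r) = trans (sym (childColour-root v u≡r)) (trans childColours≡ (childColour-root w u≡r))
      slots≡ (no u≢r) = transpose-injective _ _
        (trans (sym (childColour-nonroot v u≢r)) (trans childColours≡ (childColour-nonroot w u≢r)))

  K : ℕ
  K = Δ′ + m

  0<K : 0 < K
  0<K = ≤-trans (s≤s z≤n) (≤-trans three (m≤n+m m Δ′))

  pendantColour : V → ℕ
  pendantColour z = Δ′ + position z (leaves G)

  pendantColour<K : ∀ {z} → IsLeaf G z → pendantColour z < K
  pendantColour<K z-leaf = +-monoʳ-< Δ′ (position<length (IsLeaf⇒∈leaves z-leaf))

  pendantColour-injective : ∀ {z z'} → IsLeaf G z → IsLeaf G z' → pendantColour z ≡ pendantColour z' → z ≡ z'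
  pendantColour-injective z-leaf z'-leaf eq =
    position-injective (IsLeaf⇒∈leaves z-leaf) (IsLeaf⇒∈leaves z'-leaf) (+-cancelˡ-≡ Δ′ _ _ eq)

  inner≢pendant : ∀ {u v z} → Adj G u v → ¬ IsLeaf G u → ¬ IsLeaf G v → innerColour u v ≢ pendantColour z
  inner≢pendant u~v u-inner v-inner eq = <⇒≱ (innerColour<Δ′ u~v u-inner v-inner)
                                             (subst (Δ′ ≤_) (sym eq) (m≤m+n Δ′ _))

  colourℕ : V → V → ℕ
  colourℕ x y with IsLeaf? x | IsLeaf? y
  ... | yes _ | _ = pendantColour x
  ... | no _ | yes _ = pendantColour y
  ... | no _ | no _ = innerColour x y

  colourℕ-leaf : ∀ {x} y → IsLeaf G x → colourℕ x y ≡ pendantColour x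
  colourℕ-leaf {x} y x-leaf with IsLeaf? x
  ... | yes _ = refl
  ... | no x-inner = ⊥-elim (x-inner x-leaf)

  colourℕ-toLeaf : ∀ {x y} → ¬ IsLeaf G x → IsLeaf G y → colourℕ x y ≡ pendantColour y
  colourℕ-toLeaf {x} {y} x-inner y-leaf with IsLeaf? x | IsLeaf? y
  ... | yes x-leaf | _ = ⊥-elim (x-inner x-leaf)
  ... | no _ | yes _ = refl
  ... | no _ | no y-inner = ⊥-elim (y-inner y-leaf)

  colourℕ-inner : ∀ {x y} → ¬ IsLeaf G x → ¬ IsLeaf G y → colourℕ x y ≡ innerColour x y
  colourℕ-inner {x} {y} x-inner y-inner with IsLeaf? x | IsLeaf? y
  ... | yes x-leaf | _ = ⊥-elim (x-inner x-leaf)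
  ... | no _ | yes y-leaf = ⊥-elim (y-inner y-leaf)
  ... | no _ | no _ = refl

  data EdgeKind (x y : V) : Set where
    leaf-edge : IsLeaf G x → EdgeKind x y
    edge-leaf : ¬ IsLeaf G x → IsLeaf G y → EdgeKind x y
    inner-edge : ¬ IsLeaf G x → ¬ IsLeaf G y → EdgeKind x y

  edgeKind : ∀ x y → EdgeKind x y
  edgeKind x y with IsLeaf? x | IsLeaf? y
  ... | yes x-leaf | _ = leaf-edge x-leaf
  ... | no x-inner | yes y-leaf = edge-leaf x-inner y-leaf
  ... | no x-inner | no y-inner = inner-edge x-inner y-inner

  colourℕ<K : ∀ {x y} → Adj G x y → colourℕ x y < K
  colourℕ<K {x} {y} x~y with edgeKind x y
  ... | leaf-edge x-leaf = subst (_< K) (sym (colourℕ-leaf y x-leaf)) (pendantColour<K x-leaf)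
  ... | edge-leaf x-inner y-leaf = subst (_< K) (sym (colourℕ-toLeaf x-inner y-leaf)) (pendantColour<K y-leaf)
  ... | inner-edge x-inner y-inner = subst (_< K) (sym (colourℕ-inner x-inner y-inner))
                                           (≤-trans (innerColour<Δ′ x~y x-inner y-inner) (m≤m+n Δ′ m))

  colourℕ-sym : ∀ {x y} → Adj G x y → colourℕ x y ≡ colourℕ y x
  colourℕ-sym {x} {y} x~y with edgeKind x y | edgeKind y x
  ... | leaf-edge x-leaf | leaf-edge y-leaf = ⊥-elim (¬Adj-leaves conn three x-leaf y-leaf x~y)
  ... | leaf-edge x-leaf | edge-leaf y-inner _ = trans (colourℕ-leaf y x-leaf) (sym (colourℕ-toLeaf y-inner x-leaf))
  ... | edge-leaf x-inner y-leaf | _ = trans (colourℕ-toLeaf x-inner y-leaf) (sym (colourℕ-leaf x y-leaf))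
  ... | inner-edge x-inner y-inner | _ = begin
    colourℕ x y          ≡⟨ colourℕ-inner x-inner y-inner ⟩
    innerColour x y      ≡⟨ cong parentColour (deeperEnd-sym x~y) ⟩
    innerColour y x      ≡⟨ sym (colourℕ-inner y-inner x-inner) ⟩
    colourℕ y x          ∎
    where open ≡-Reasoning
  ... | leaf-edge x-leaf | inner-edge _ x-inner = ⊥-elim (x-inner x-leaf)


  colourℕ-proper : ∀ {u v w} → Adj G u v → Adj G u w → colourℕ u v ≡ colourℕ u w → v ≡ w
  colourℕ-proper {u} {v} {w} u~v u~w eq with edgeKind u v | edgeKind u w
  ... | leaf-edge u-leaf | _ = leaf-neighbour-unique u-leaf u~v u~w
  ... | edge-leaf _ _ | leaf-edge u-leaf = leaf-neighbour-unique u-leaf u~v u~w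
  ... | inner-edge _ _ | leaf-edge u-leaf = leaf-neighbour-unique u-leaf u~v u~w
  ... | edge-leaf u-inner v-leaf | edge-leaf _ w-leaf =
        pendantColour-injective v-leaf w-leaf
          (trans (sym (colourℕ-toLeaf u-inner v-leaf)) (trans eq (colourℕ-toLeaf u-inner w-leaf)))
  ... | edge-leaf u-inner v-leaf | inner-edge _ w-inner =
        ⊥-elim (inner≢pendant u~w u-inner w-inner
          (trans (sym (colourℕ-inner u-inner w-inner)) (trans (sym eq) (colourℕ-toLeaf u-inner v-leaf))))
  ... | inner-edge u-inner v-inner | edge-leaf _ w-leaf =
        ⊥-elim (inner≢pendant u~v u-inner v-inner
          (trans (sym (colourℕ-inner u-inner v-inner)) (trans eq (colourℕ-toLeaf u-inner w-leaf))))
  ... | inner-edge u-inner v-inner | inner-edge _ w-inner =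
        innerColour-injective u~v u~w v-inner w-inner
          (trans (sym (colourℕ-inner u-inner v-inner)) (trans eq (colourℕ-inner u-inner w-inner)))

  colour : V → V → Fin K
  colour x y = toFin 0<K (colourℕ x y)

  colour-onto : ∀ (i : Fin K) → Σ V λ x → Σ V λ y → Adj G x y × colour x y ≡ i
  colour-onto i with toℕ i <? Δ′
  ... | yes i<Δ′ = r , w , r~w , trans (cong (toFin 0<K) colour≡i) (toFin-toℕ 0<K i)
    where
      j = fromℕ< (subst (toℕ i <_) (sym degInner-r) i<Δ′)
      w = lookup (innerNeighbours r) j
      r~w = proj₁ (∈innerNeighbours⇒ (∈-lookup j))
      colour≡i : colourℕ r w ≡ toℕ i
      colour≡i = begin
        colourℕ r w                     ≡⟨ colourℕ-inner r-inner (proj₂ (∈innerNeighbours⇒ (∈-lookup j))) ⟩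
        innerColour r w                 ≡⟨ innerColour-child (proj₁ (root-child r~w)) (proj₂ (root-child r~w)) ⟩
        childColour parentColour r w    ≡⟨ childColour-root w refl ⟩
        slot r w                        ≡⟨ position-lookup (innerNeighbours-unique r) j ⟩
        toℕ j                           ≡⟨ FP.toℕ-fromℕ< _ ⟩
        toℕ i                           ∎
        where open ≡-Reasoning
  ... | no i≮Δ′ = ℓ , proj₁ (leaf-neighbour ℓ-leaf) , proj₂ (leaf-neighbour ℓ-leaf) ,
                  trans (cong (toFin 0<K) colour≡i) (toFin-toℕ 0<K i)
    where
      Δ′≤i = ≮⇒≥ i≮Δ′
      k<m : toℕ i ∸ Δ′ < length (leaves G)
      k<m = +-cancelˡ-< Δ′ _ _ (subst (_< Δ′ + m) (sym (m+[n∸m]≡n Δ′≤i)) (FP.toℕ<n i))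
      j = fromℕ< k<m
      ℓ = lookup (leaves G) j
      ℓ-leaf = ∈leaves⇒IsLeaf (∈-lookup j)
      colour≡i : colourℕ ℓ (proj₁ (leaf-neighbour ℓ-leaf)) ≡ toℕ i
      colour≡i = begin
        colourℕ ℓ _                       ≡⟨ colourℕ-leaf _ ℓ-leaf ⟩
        Δ′ + position ℓ (leaves G)        ≡⟨ cong (Δ′ +_)
                                            (trans (position-lookup leaves-unique j) (FP.toℕ-fromℕ< k<m)) ⟩
        Δ′ + (toℕ i ∸ Δ′)                 ≡⟨ m+[n∸m]≡n Δ′≤i ⟩
        toℕ i                             ∎
        where open ≡-Reasoning

  colouring : EdgeColoring G K
  colouring = record
    { col = colour
    ; col-sym = λ u v u~v → cong (toFin 0<K) (colourℕ-sym u~v)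
    ; proper = λ u v w u~v u~w v≢w eq → v≢w
        (colourℕ-proper u~v u~w (toFin-injective 0<K (colourℕ<K u~v) (colourℕ<K u~w) eq))
    ; surj = colour-onto
    }

  open Separation colouring

  pendantClass : V → Fin K
  pendantClass z = toFin 0<K (pendantColour z)

  colour-toLeaf : ∀ {z s} → IsLeaf G z → Adj G s z → colour s z ≡ pendantClass z
  colour-toLeaf z-leaf s~z =
    cong (toFin 0<K) (colourℕ-toLeaf (λ s-leaf → ¬Adj-leaves conn three z-leaf s-leaf (Adj-sym s~z)) z-leaf)

  pendantClass-edge : ∀ {z a b} → IsLeaf G z → Adj G a b → colour a b ≡ pendantClass z → a ≡ z ⊎ Adj G a z
  pendantClass-edge {z} {a} {b} z-leaf a~b eq with edgeKind a b | toFin-injective 0<K (colourℕ<K a~b) (pendantColour<K z-leaf) eq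
  ... | leaf-edge a-leaf | eqℕ = inj₁ (pendantColour-injective a-leaf z-leaf (trans (sym (colourℕ-leaf b a-leaf)) eqℕ))
  ... | edge-leaf a-inner b-leaf | eqℕ =
        inj₂ (subst (Adj G a) (pendantColour-injective b-leaf z-leaf (trans (sym (colourℕ-toLeaf a-inner b-leaf)) eqℕ)) a~b)
  ... | inner-edge a-inner b-inner | eqℕ =
      ⊥-elim (inner≢pendant a~b a-inner b-inner (trans (sym (colourℕ-inner a-inner b-inner)) eqℕ))

  -- The pendant class of z is the single edge at z.
  dist≤distToPendantClass : ∀ {x z d} → IsLeaf G z → DistToClass G colouring x (pendantClass z) d → dist x z ≤ suc d
  dist≤distToPendantClass {x} {z} {d} z-leaf ((a , b , a~b , ab∈class , x→a) , _) =
    Sum.[ (λ { refl → ≤-trans (dist-minimal x→a) (n≤1+n d) })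
          , (λ a~z → ≤-trans (dist-step a~z) (s≤s (dist-minimal x→a))) ]
      (pendantClass-edge z-leaf a~b ab∈class)

  separatedByLeafBelow : ∀ {x y z t} → IsLeaf G z → Walk G y z (suc t) → 1 ≤ dist x y →
                         dist x z ≡ suc t + dist x y → Separates x y
  separatedByLeafBelow {x} {y} {z} {t} z-leaf y→z 1≤D dist-z with unsnoc y→z
  ... | w , y→w , w~z = separatedBy (pendantClass z) λ {d₁} {d₂} x→class y→class d₁≡d₂ →
        <-irrefl (sym d₁≡d₂) (begin-strict
          d₂                    ≤⟨ proj₂ y→class w z t w~z (colour-toLeaf z-leaf w~z) y→w ⟩
          t                     <⟨ m<m+n t 1≤D ⟩
          t + dist x y          ≤⟨ s≤s⁻¹ (subst (_≤ suc d₁) dist-z (dist≤distToPendantClass z-leaf x→class)) ⟩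
          d₁                    ∎)
    where open ≤-Reasoning

  separatedByLeaf : ∀ {x y} → x ≢ y → IsLeaf G y → Separates x y ⊎ Adj G x y
  separatedByLeaf {x} {y} x≢y y-leaf = byDistance (proj₂ (distToClass x (pendantClass y)))
    where
      byDistance : ∀ {d} → DistToClass G colouring x (pendantClass y) d → Separates x y ⊎ Adj G x y
      byDistance {zero} ((a , b , a~b , ab∈class , here) , _) =
        Sum.map (λ x≡y → ⊥-elim (x≢y x≡y)) (λ x~y → x~y) (pendantClass-edge y-leaf a~b ab∈class)
      byDistance {suc d} x→class =
        inj₁ (pendantClass y , suc d , 0 , x→class , incident⇒distToClass≡0 y~s colour-fromLeaf , λ ())
        where
          y~s = proj₂ (leaf-neighbour y-leaf)
          colour-fromLeaf : colour y (proj₁ (leaf-neighbour y-leaf)) ≡ pendantClass y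
          colour-fromLeaf = cong (toFin 0<K) (colourℕ-leaf _ y-leaf)

  separates-or-leafNeighbour : ∀ {x y} → x ≢ y → Separates x y ⊎ (IsLeaf G y × Adj G x y)
  separates-or-leafNeighbour {x} {y} x≢y = viaLeafBelow (X.leafBelow y y≢x)
    where
      module X = RootedTree G conn acyc x
      y≢x : y ≢ x
      y≢x y≡x = x≢y (sym y≡x)
      viaLeafBelow : X.LeafBelow y → Separates x y ⊎ (IsLeaf G y × Adj G x y)
      viaLeafBelow record { height = zero ; isLeaf = y-leaf ; parent^-leaf = refl } =
        Sum.map₂ (y-leaf ,_) (separatedByLeaf x≢y y-leaf)
      viaLeafBelow record { leaf = z ; height = suc t ; isLeaf = z-leaf ; depth-leaf = dist-z ; parent^-leaf = z↑y } =
        inj₁ (separatedByLeafBelow z-leaf (subst (λ u → Walk G u z (suc t)) z↑y (X.parent^-walk (suc t) z t<))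
                                   (X.≢root⇒1≤depth y≢x) dist-z)
        where
          t< : suc t ≤ dist x z
          t< = subst (suc t ≤_) (sym dist-z) (m≤m+n (suc t) _)

  colouring-locating : IsEdgeLocating G colouring
  colouring-locating x y x≢y = Sum.[ (λ separates → separates) , viaLeaf ] (separates-or-leafNeighbour x≢y)
    where
      viaLeaf : IsLeaf G y × Adj G x y → Separates x y
      viaLeaf (y-leaf , x~y) = Sum.[ Separates-sym ,
                                          (λ { (x-leaf , _) → ⊥-elim (¬Adj-leaves conn three x-leaf y-leaf x~y) }) ]
                                        (separates-or-leafNeighbour λ y≡x → x≢y (sym y≡x))

  χ′L≤ : ChiL≤ G (ΔInner G + numLeaves G)
  χ′L≤ = K , ≤-refl , colouring , colouring-locating

module Spider (G : Graph) (conn : Connected G) (acyc : ¬ HasCycle G) (three : 3 ≤ numLeaves G)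
              (r : Fin (n G)) (deg-r : deg G r ≡ numLeaves G) where
  open RootedTree G conn acyc r
  open Leaves G

  m : ℕ
  m = numLeaves G

  legs : List V
  legs = neighbours r

  length-legs : length legs ≡ m
  length-legs = trans (length-neighbours r) deg-r

  ∈legs⇒depth≡1 : ∀ {y} → y ∈ legs → depth y ≡ 1
  ∈legs⇒depth≡1 y∈ with Adj⇒depth-step (∈neighbours⇒Adj y∈)
  ... | inj₁ d≡ = trans d≡ (cong suc depth-root)
  ... | inj₂ d≡ = ⊥-elim (0≢1+n (trans (sym depth-root) d≡))

  depth≡1⇒∈legs : ∀ {v} → depth v ≡ 1 → v ∈ legs
  depth≡1⇒∈legs {v} d≡1 = Adj⇒∈neighbours (subst (λ p → Adj G p v) (depth≡0⇒≡root depth-p≡0) (parent-Adj v≢r))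
    where
      v≢r = depth≡suc⇒≢root d≡1
      depth-p≡0 = suc-injective (trans (sym (depth-parent v≢r)) d≡1)

  legOf : V → V
  legOf = ancestor 1

  legOf∈legs : ∀ {v} → v ≢ r → legOf v ∈ legs
  legOf∈legs {v} v≢r = depth≡1⇒∈legs (+-cancelʳ-≡ (depth v ∸ 1) _ _ (begin
    depth (legOf v) + (depth v ∸ 1)    ≡⟨ depth-parent^ (depth v ∸ 1) v (m∸n≤m (depth v) 1) ⟩
    depth v                            ≡⟨ sym (m+[n∸m]≡n (≢root⇒1≤depth v≢r)) ⟩
    1 + (depth v ∸ 1)                  ∎))
    where open ≡-Reasoning

  legOf-leg : ∀ {y} → y ∈ legs → legOf y ≡ y
  legOf-leg {y} y∈ = trans (cong (λ k → ancestor k y) (sym (∈legs⇒depth≡1 y∈))) (ancestor-self y)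

  legOf-Adj : ∀ {v w} → Adj G v w → v ≢ r → w ≢ r → legOf v ≡ legOf w
  legOf-Adj v~w v≢r w≢r with Adj⇒parent⊎child v~w
  ... | inj₁ (w≡parent , _) = trans (ancestor-parent v≢r (subst (λ z → 1 ≤ depth z) w≡parent (≢root⇒1≤depth w≢r)))
                                    (cong legOf (sym w≡parent))
  ... | inj₂ (v≡parent , _) = sym (trans (ancestor-parent w≢r
                                         (subst (λ z → 1 ≤ depth z) v≡parent (≢root⇒1≤depth v≢r)))
                                         (cong legOf (sym v≡parent)))

  legOf-leafBelow : ∀ {y} (below : LeafBelow y) → y ≢ r → legOf (LeafBelow.leaf below) ≡ legOf y
  legOf-leafBelow below y≢r = ancestor-below (LeafBelow.parent^-leaf below) (LeafBelow.depth-leaf below) (≢root⇒1≤depth y≢r)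

  leafOnLeg : ∀ {y} → y ∈ legs → Σ V λ z → IsLeaf G z × legOf z ≡ y
  leafOnLeg {y} y∈ = LeafBelow.leaf below , LeafBelow.isLeaf below , trans (legOf-leafBelow below y≢r) (legOf-leg y∈)
    where
      y≢r : y ≢ r
      y≢r y≡r = Adj⇒≢ (∈neighbours⇒Adj y∈) (sym y≡r)
      below = leafBelow y y≢r

  -- Each of the m legs carries a leaf, so a second leaf on one leg would be an (m+1)-st.
  leaf-on-leg-unique : ∀ {z₁ z₂} → IsLeaf G z₁ → IsLeaf G z₂ → legOf z₁ ≡ legOf z₂ → z₁ ≡ z₂
  leaf-on-leg-unique {z₁} {z₂} z₁-leaf z₂-leaf same-leg with z₁ FP.≟ z₂
  ... | yes z₁≡z₂ = z₁≡z₂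
  ... | no z₁≢z₂ = ⊥-elim (<-irrefl refl
      (subst (_≤ m) (cong suc length-legs) (injection⇒≤numLeaves chosen chosen-leaf chosen-injective)))
    where
      legLeaf : ∀ {y} → y ∈ legs → V
      legLeaf {y} y∈ with y FP.≟ legOf z₁
      ... | yes _ = z₁
      ... | no _ = proj₁ (leafOnLeg y∈)
      legLeaf-leaf : ∀ {y} (y∈ : y ∈ legs) → IsLeaf G (legLeaf y∈)
      legLeaf-leaf {y} y∈ with y FP.≟ legOf z₁
      ... | yes _ = z₁-leaf
      ... | no _ = proj₁ (proj₂ (leafOnLeg y∈))
      legOf-legLeaf : ∀ {y} (y∈ : y ∈ legs) → legOf (legLeaf y∈) ≡ y
      legOf-legLeaf {y} y∈ with y FP.≟ legOf z₁
      ... | yes y≡ = sym y≡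
      ... | no _ = proj₂ (proj₂ (leafOnLeg y∈))
      legLeaf-own : ∀ {y} (y∈ : y ∈ legs) → y ≡ legOf z₁ → legLeaf y∈ ≡ z₁
      legLeaf-own {y} y∈ y≡ with y FP.≟ legOf z₁
      ... | yes _ = refl
      ... | no y≢ = ⊥-elim (y≢ y≡)
      chosen : Fin (suc (length legs)) → V
      chosen F.zero = z₂
      chosen (F.suc i) = legLeaf (∈-lookup i)
      chosen-leaf : ∀ i → IsLeaf G (chosen i)
      chosen-leaf F.zero = z₂-leaf
      chosen-leaf (F.suc i) = legLeaf-leaf (∈-lookup i)
      z₂≢legLeaf : ∀ i → z₂ ≢ legLeaf (∈-lookup {xs = legs} i)
      z₂≢legLeaf i z₂≡ = z₁≢z₂ (sym (trans z₂≡ (legLeaf-own (∈-lookup i)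
        (trans (sym (legOf-legLeaf (∈-lookup i))) (trans (cong legOf (sym z₂≡)) (sym same-leg))))))
      chosen-injective : Injective _≡_ _≡_ chosen
      chosen-injective {F.zero} {F.zero} _ = refl
      chosen-injective {F.zero} {F.suc j} eq = ⊥-elim (z₂≢legLeaf j eq)
      chosen-injective {F.suc i} {F.zero} eq = ⊥-elim (z₂≢legLeaf i (sym eq))
      chosen-injective {F.suc i} {F.suc j} eq = cong F.suc (lookup-injective (neighbours-unique r)
        (trans (sym (legOf-legLeaf (∈-lookup i))) (trans (cong legOf eq) (legOf-legLeaf (∈-lookup j)))))

  child-unique : ∀ {u c₁ c₂} → u ≢ r → IsParent c₁ u → IsParent c₂ u → c₁ ≡ c₂
  child-unique {u} {c₁} {c₂} u≢r (u~c₁ , d₁) (u~c₂ , d₂) = begin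
    c₁                                                ≡⟨ sym (ancestor-leafBelow below₁) ⟩
    ancestor (depth c₁) (LeafBelow.leaf below₁)       ≡⟨ cong₂ ancestor (trans d₁ (sym d₂)) leaves≡ ⟩
    ancestor (depth c₂) (LeafBelow.leaf below₂)       ≡⟨ ancestor-leafBelow below₂ ⟩
    c₂                                                ∎
    where
      open ≡-Reasoning
      c₁≢r = depth≡suc⇒≢root d₁
      c₂≢r = depth≡suc⇒≢root d₂
      below₁ = leafBelow c₁ c₁≢r
      below₂ = leafBelow c₂ c₂≢r
      leaves≡ : LeafBelow.leaf below₁ ≡ LeafBelow.leaf below₂
      leaves≡ = leaf-on-leg-unique (LeafBelow.isLeaf below₁) (LeafBelow.isLeaf below₂) (begin
        legOf (LeafBelow.leaf below₁)    ≡⟨ legOf-leafBelow below₁ c₁≢r ⟩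
        legOf c₁                         ≡⟨ legOf-Adj u~c₁ u≢r c₁≢r ⟨
        legOf u                          ≡⟨ legOf-Adj u~c₂ u≢r c₂≢r ⟩
        legOf c₂                         ≡⟨ legOf-leafBelow below₂ c₂≢r ⟨
        legOf (LeafBelow.leaf below₂)    ∎)

  next : ℕ → ℕ
  next i with suc i <? m
  ... | yes _ = suc i
  ... | no _ = 0

  next-cases : ∀ {i} → i < m → (suc i < m × next i ≡ suc i) ⊎ (suc i ≡ m × next i ≡ 0)
  next-cases {i} i<m with suc i <? m
  ... | yes 1+i<m = inj₁ (1+i<m , refl)
  ... | no 1+i≮m = inj₂ (≤-antisym i<m (≮⇒≥ 1+i≮m) , refl)

  next<m : ∀ i → next i < m
  next<m i with suc i <? m
  ... | yes 1+i<m = 1+i<m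
  ... | no _ = ≤-trans (s≤s z≤n) three

  m≢small : ∀ {k} → k < 3 → m ≢ k
  m≢small k<3 m≡k = <⇒≱ k<3 (subst (3 ≤_) m≡k three)

  next≢self : ∀ {i} → i < m → next i ≢ i
  next≢self i<m eq with next-cases i<m
  ... | inj₁ (_ , eq′) = 1+n≢n (trans (sym eq′) eq)
  ... | inj₂ (1+i≡m , eq′) = m≢small (s≤s (s≤s z≤n)) (trans (sym 1+i≡m) (cong suc (trans (sym eq) eq′)))

  next²≢self : ∀ {i} → i < m → next (next i) ≢ i
  next²≢self {i} i<m eq with next-cases i<m
  ... | inj₁ (1+i<m , eq₁) with next-cases 1+i<m
  ...   | inj₁ (_ , eq₂) = <⇒≢ (≤-trans (n<1+n i) (n≤1+n _)) (sym (trans (sym eq₂) (trans (cong next (sym eq₁)) eq)))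
  ...   | inj₂ (2+i≡m , eq₂) = m≢small ≤-refl
          (trans (sym 2+i≡m) (cong (suc ∘′ suc) (trans (sym eq) (trans (cong next eq₁) eq₂))))
  next²≢self {i} i<m eq | inj₂ (1+i≡m , eq₁) with next-cases (≤-trans (s≤s z≤n) three)
  ... | inj₁ (_ , eq₂) = m≢small ≤-refl (trans (sym 1+i≡m) (cong suc (trans (sym eq) (trans (cong next eq₁) eq₂))))
  ... | inj₂ (1≡m , _) = m≢small (s≤s (s≤s z≤n)) (sym 1≡m)

  next-injective : ∀ {i j} → i < m → j < m → next i ≡ next j → i ≡ j
  next-injective i<m j<m eq with next-cases i<m | next-cases j<m
  ... | inj₁ (_ , eqᵢ) | inj₁ (_ , eqⱼ) = suc-injective (trans (sym eqᵢ) (trans eq eqⱼ))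
  ... | inj₁ (_ , eqᵢ) | inj₂ (_ , eqⱼ) = ⊥-elim (0≢1+n (sym (trans (sym eqᵢ) (trans eq eqⱼ))))
  ... | inj₂ (_ , eqᵢ) | inj₁ (_ , eqⱼ) = ⊥-elim (0≢1+n (trans (sym eqᵢ) (trans eq eqⱼ)))
  ... | inj₂ (1+i≡m , _) | inj₂ (1+j≡m , _) = suc-injective (trans 1+i≡m (sym 1+j≡m))

  UsedOnLeg : ℕ → ℕ → Set
  UsedOnLeg k i = k ≡ i ⊎ k ≡ next i

  UsedOnLeg? : ∀ k i → Dec (UsedOnLeg k i)
  UsedOnLeg? k i = (k ≟ i) ⊎-dec (k ≟ next i)

  next²-unused : ∀ {i} → i < m → ¬ UsedOnLeg (next (next i)) i
  next²-unused i<m (inj₁ eq) = next²≢self i<m eq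
  next²-unused {i} i<m (inj₂ eq) = next≢self (next<m i) eq

  -- Legs i ≠ i' at the same depth use colours in the same phase, so they cannot each use the other's colour.
  crossed-colours-impossible : ∀ {i i'} → i < m → i' < m → i ≢ i' → ∀ j →
    UsedOnLeg (alternating i (next i) j) i' → UsedOnLeg (alternating i' (next i') j) i → ⊥
  crossed-colours-impossible {i} {i'} i<m i'<m i≢i' j used used' with alternating-inPhase i (next i) i' (next i') j
  ... | inj₁ (eq , eq') with subst (λ k → UsedOnLeg k i') eq used | subst (λ k → UsedOnLeg k i) eq' used'
  ...   | inj₁ i≡i' | _ = i≢i' i≡i'
  ...   | _ | inj₁ i'≡i = i≢i' (sym i'≡i)
  ...   | inj₂ i≡next | inj₂ i'≡next = next²≢self i<m (trans (cong next (sym i'≡next)) (sym i≡next))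
  crossed-colours-impossible {i} {i'} i<m i'<m i≢i' j used used' | inj₂ (eq , eq')
    with subst (λ k → UsedOnLeg k i') eq used | subst (λ k → UsedOnLeg k i) eq' used'
  ... | inj₂ next≡ | _ = i≢i' (next-injective i<m i'<m next≡)
  ... | _ | inj₂ next≡ = i≢i' (sym (next-injective i'<m i<m next≡))
  ... | inj₁ next-i≡i' | inj₁ next-i'≡i = next²≢self i<m (trans (cong next next-i≡i') next-i'≡i)

  legIndex : V → ℕ
  legIndex v = position (legOf v) legs

  legIndex<m : ∀ {v} → v ≢ r → legIndex v < m
  legIndex<m {v} v≢r = subst (legIndex v <_) length-legs (position<length (legOf∈legs v≢r))

  legIndex-Adj : ∀ {v w} → Adj G v w → v ≢ r → w ≢ r → legIndex v ≡ legIndex w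
  legIndex-Adj v~w v≢r w≢r = cong (λ z → position z legs) (legOf-Adj v~w v≢r w≢r)

  -- The edges of leg i alternate between the colours next i and i, starting with i at the root.
  parentColour : V → ℕ
  parentColour v = alternating (legIndex v) (next (legIndex v)) (depth v)

  parentColour-used : ∀ v → UsedOnLeg (parentColour v) (legIndex v)
  parentColour-used v = alternating-∈ (legIndex v) (next (legIndex v)) (depth v)

  parentColour<m : ∀ {v} → v ≢ r → parentColour v < m
  parentColour<m {v} v≢r with parentColour-used v
  ... | inj₁ eq = subst (_< m) (sym eq) (legIndex<m v≢r)
  ... | inj₂ eq = subst (_< m) (sym eq) (next<m (legIndex v))

  parentColour-leg : ∀ {y} → y ∈ legs → parentColour y ≡ position y legs
  parentColour-leg {y} y∈ = trans (cong (alternating (legIndex y) (next (legIndex y))) (∈legs⇒depth≡1 y∈))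
                                  (cong (λ z → position z legs) (legOf-leg y∈))

  colourℕ : V → V → ℕ
  colourℕ u v = parentColour (deeperEnd u v)

  colourℕ-cases : ∀ {u v} → Adj G u v → (colourℕ u v ≡ parentColour u × u ≢ r)
                  ⊎ (colourℕ u v ≡ parentColour v × v ≢ r)
  colourℕ-cases u~v = Sum.map (λ { (_ , d≡) → cong parentColour (deeperEnd-parent d≡) , depth≡suc⇒≢root d≡ })
                                   (λ { (_ , d≡) → cong parentColour (deeperEnd-child d≡) , depth≡suc⇒≢root d≡ })
                                   (Adj⇒parent⊎child u~v)

  colourℕ<m : ∀ {u v} → Adj G u v → colourℕ u v < m
  colourℕ<m u~v with colourℕ-cases u~v
  ... | inj₁ (eq , u≢r) = subst (_< m) (sym eq) (parentColour<m u≢r)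
  ... | inj₂ (eq , v≢r) = subst (_< m) (sym eq) (parentColour<m v≢r)

  colourℕ-used : ∀ {a b} → Adj G a b → a ≢ r → UsedOnLeg (colourℕ a b) (legIndex a)
  colourℕ-used {a} {b} a~b a≢r with colourℕ-cases a~b
  ... | inj₁ (eq , _) = subst (λ k → UsedOnLeg k (legIndex a)) (sym eq) (parentColour-used a)
  ... | inj₂ (eq , b≢r) = subst₂ UsedOnLeg (sym eq) (sym (legIndex-Adj a~b a≢r b≢r)) (parentColour-used b)

  parentColour-alternates : ∀ {u w} → u ≢ r → Adj G u w → depth w ≡ suc (depth u) → parentColour w ≢ parentColour u
  parentColour-alternates {u} {w} u≢r u~w d≡ eq =
    alternating-step (λ i≡next → next≢self (legIndex<m u≢r) (sym i≡next))
      (depth u) (begin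
    alternating i (next i) (suc (depth u))    ≡⟨ cong (alternating i (next i)) (sym d≡) ⟩
    alternating i (next i) (depth w)
          ≡⟨ cong (λ i → alternating i (next i) (depth w)) (legIndex-Adj u~w u≢r (depth≡suc⇒≢root d≡)) ⟩
    parentColour w                            ≡⟨ eq ⟩
    parentColour u                            ∎)
    where
      open ≡-Reasoning
      i = legIndex u

  colourℕ-proper : ∀ {u v w} → Adj G u v → Adj G u w → colourℕ u v ≡ colourℕ u w → v ≡ w
  colourℕ-proper {u} {v} {w} u~v u~w eq with Adj⇒parent⊎child u~v | Adj⇒parent⊎child u~w
  ... | inj₁ (v≡parent , _) | inj₁ (w≡parent , _) = trans v≡parent (sym w≡parent)
  ... | inj₁ (_ , d≡) | inj₂ (_ , d≡′) = ⊥-elim (parentColour-alternates (depth≡suc⇒≢root d≡) u~w d≡′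
          (trans (sym (cong parentColour (deeperEnd-child d≡′))) (trans (sym eq) (cong parentColour (deeperEnd-parent d≡)))))
  ... | inj₂ (_ , d≡′) | inj₁ (_ , d≡) = ⊥-elim (parentColour-alternates (depth≡suc⇒≢root d≡) u~v d≡′
          (trans (sym (cong parentColour (deeperEnd-child d≡′))) (trans eq (cong parentColour (deeperEnd-parent d≡)))))
  ... | inj₂ (_ , d≡v) | inj₂ (_ , d≡w) with u FP.≟ r
  ...   | no u≢r = child-unique u≢r (u~v , d≡v) (u~w , d≡w)
  ...   | yes refl = position-injective (Adj⇒∈neighbours u~v) (Adj⇒∈neighbours u~w) (begin
    position v legs      ≡⟨ sym (parentColour-leg (Adj⇒∈neighbours u~v)) ⟩
    parentColour v       ≡⟨ cong parentColour (sym (deeperEnd-child d≡v)) ⟩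
    colourℕ r v          ≡⟨ eq ⟩
    colourℕ r w          ≡⟨ cong parentColour (deeperEnd-child d≡w) ⟩
    parentColour w       ≡⟨ parentColour-leg (Adj⇒∈neighbours u~w) ⟩
    position w legs      ∎)
    where open ≡-Reasoning

  0<m : 0 < m
  0<m = ≤-trans (s≤s z≤n) three

  colour : V → V → Fin m
  colour u v = toFin 0<m (colourℕ u v)

  rootEdge : Fin m → V
  rootEdge k = lookup legs (fromℕ< (subst (toℕ k <_) (sym length-legs) (FP.toℕ<n k)))

  rootEdge-Adj : ∀ k → Adj G r (rootEdge k)
  rootEdge-Adj k = ∈neighbours⇒Adj (∈-lookup _)

  colour-rootEdge : ∀ k → colour r (rootEdge k) ≡ k
  colour-rootEdge k = FP.toℕ-injective (begin
    toℕ (colour r y)       ≡⟨ toℕ-toFin 0<m (colourℕ<m (rootEdge-Adj k)) ⟩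
    colourℕ r y            ≡⟨ cong parentColour (deeperEnd-child depth-y) ⟩
    parentColour y         ≡⟨ parentColour-leg (∈-lookup j) ⟩
    position y legs        ≡⟨ position-lookup (neighbours-unique r) j ⟩
    toℕ j                  ≡⟨ FP.toℕ-fromℕ< _ ⟩
    toℕ k                  ∎)
    where
      open ≡-Reasoning
      j = fromℕ< (subst (toℕ k <_) (sym length-legs) (FP.toℕ<n k))
      y = rootEdge k
      depth-y : depth y ≡ suc (depth r)
      depth-y = trans (∈legs⇒depth≡1 (∈-lookup j)) (cong suc (sym depth-root))

  colouring : EdgeColoring G m
  colouring = record
    { col = colour
    ; col-sym = λ u v u~v → cong (λ z → toFin 0<m (parentColour z)) (deeperEnd-sym u~v)
    ; proper = λ u v w u~v u~w v≢w eq → v≢w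
        (colourℕ-proper u~v u~w (toFin-injective 0<m (colourℕ<m u~v) (colourℕ<m u~w) eq))
    ; surj = λ k → r , rootEdge k , rootEdge-Adj k , colour-rootEdge k
    }

  open Separation colouring

  toℕ-colour : ∀ {a b} → Adj G a b → toℕ (colour a b) ≡ colourℕ a b
  toℕ-colour a~b = toℕ-toFin 0<m (colourℕ<m a~b)

  distToClass≤depth : ∀ {v k d} → DistToClass G colouring v k d → d ≤ depth v
  distToClass≤depth {v} {k} (_ , minimal) =
    minimal r (rootEdge k) (depth v) (rootEdge-Adj k) (colour-rootEdge k) (reverse (dist-walk r v))

  distToClass-root : ∀ {k d} → DistToClass G colouring r k d → d ≡ 0
  distToClass-root r→k = n≤0⇒n≡0 (≤-trans (distToClass≤depth r→k) (≤-reflexive depth-root))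

  distToClass-incident : ∀ {x b d} → Adj G x b → DistToClass G colouring x (colour x b) d → d ≡ 0
  distToClass-incident {x} {b} x~b (_ , minimal) = n≤0⇒n≡0 (minimal x b 0 x~b refl here)

  distToClass≡0⇒used : ∀ {v k} → v ≢ r → DistToClass G colouring v k 0 → UsedOnLeg (toℕ k) (legIndex v)
  distToClass≡0⇒used {v} v≢r ((a , b , a~b , refl , here) , _) =
    subst (λ c → UsedOnLeg c (legIndex v)) (sym (toℕ-colour a~b)) (colourℕ-used a~b v≢r)

  short-walk-stays-on-leg : ∀ {v a L} → Walk G v a L → L < depth v → a ≢ r × legOf a ≡ legOf v
  short-walk-stays-on-leg here L<d = <depth⇒≢root L<d , refl
  short-walk-stays-on-leg {v} (step {w = w} v~w w→a) L<d =
    proj₁ rest , trans (proj₂ rest) (legOf-Adj (Adj-sym v~w) (<depth⇒≢root L'<d) (<depth⇒≢root L<d))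
    where
      L'<d : _ < depth w
      L'<d = s≤s⁻¹ (≤-trans L<d (dist-step (Adj-sym v~w)))
      rest = short-walk-stays-on-leg w→a L'<d

  depth≤distToClass : ∀ {v k d} → v ≢ r → ¬ UsedOnLeg (toℕ k) (legIndex v)
                      → DistToClass G colouring v k d → depth v ≤ d
  depth≤distToClass {v} {k} {d} v≢r unused ((a , b , a~b , ab∈k , v→a) , _) = ≮⇒≥ λ d< →
    unused (subst₂ UsedOnLeg (trans (sym (toℕ-colour a~b)) (cong toℕ ab∈k))
                             (cong (λ z → position z legs) (proj₂ (short-walk-stays-on-leg v→a d<)))
                             (colourℕ-used a~b (proj₁ (short-walk-stays-on-leg v→a d<))))

  separatedByUnused : ∀ {x y} k → (∀ {d} → DistToClass G colouring x k d → d ≡ 0) → y ≢ r →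
                      ¬ UsedOnLeg (toℕ k) (legIndex y) → Separates x y
  separatedByUnused {x} {y} k x-at-k y≢r unused = separatedBy k λ x→k y→k d₁≡d₂ →
    unused (distToClass≡0⇒used y≢r (subst (DistToClass G colouring y k) (trans (sym d₁≡d₂) (x-at-k x→k)) y→k))

  -- A class not used on the leg of v, so that v reaches it only through r.
  farClass : V → Fin m
  farClass v = fromℕ< (next<m (next (legIndex v)))

  farClass-unused : ∀ {v} → v ≢ r → ¬ UsedOnLeg (toℕ (farClass v)) (legIndex v)
  farClass-unused {v} v≢r = subst (λ k → ¬ UsedOnLeg k (legIndex v)) (sym (FP.toℕ-fromℕ< _))
    (next²-unused (legIndex<m v≢r))

  root-separated : ∀ {y} → y ≢ r → Separates r y
  root-separated y≢r = separatedByUnused (farClass _) distToClass-root y≢r (farClass-unused y≢r)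

  shallower-separated : ∀ {x y} → x ≢ r → depth y < depth x → Separates x y
  shallower-separated {x} {y} x≢r d< = separatedBy (farClass x) λ {d₁} {d₂} x→k y→k d₁≡d₂ →
    <⇒≢ (begin-strict
      d₂         ≤⟨ distToClass≤depth y→k ⟩
      depth y    <⟨ d< ⟩
      depth x    ≤⟨ depth≤distToClass x≢r (farClass-unused x≢r) x→k ⟩
      d₁         ∎) (sym d₁≡d₂)
    where open ≤-Reasoning

  sameDepth-sameLeg⇒≡ : ∀ D {x y} → depth x ≡ suc D → depth y ≡ suc D → legOf x ≡ legOf y → x ≡ y
  sameDepth-sameLeg⇒≡ zero {x} {y} dx dy leg≡ = begin
    x          ≡⟨ cong (λ k → parent^ (k ∸ 1) x) (sym dx) ⟩
    legOf x    ≡⟨ leg≡ ⟩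
    legOf y    ≡⟨ cong (λ k → parent^ (k ∸ 1) y) dy ⟩
    y          ∎
    where open ≡-Reasoning
  sameDepth-sameLeg⇒≡ (suc D) {x} {y} dx dy leg≡ =
    child-unique (depth≡suc⇒≢root dpx) (parent-isParent x≢r) (subst (IsParent y) (sym parents≡) (parent-isParent y≢r))
    where
      x≢r = depth≡suc⇒≢root dx
      y≢r = depth≡suc⇒≢root dy
      dpx = suc-injective (trans (sym (depth-parent x≢r)) dx)
      dpy = suc-injective (trans (sym (depth-parent y≢r)) dy)
      parents≡ : parent x ≡ parent y
      parents≡ = sameDepth-sameLeg⇒≡ D dpx dpy (begin
        legOf (parent x)    ≡⟨ legOf-Adj (parent-Adj x≢r) (depth≡suc⇒≢root dpx) x≢r ⟩
        legOf x             ≡⟨ leg≡ ⟩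
        legOf y             ≡⟨ legOf-Adj (Adj-sym (parent-Adj y≢r)) y≢r (depth≡suc⇒≢root dpy) ⟩
        legOf (parent y)    ∎)
        where open ≡-Reasoning

  parentClass : V → Fin m
  parentClass x = colour x (parent x)

  parentClass-separates : ∀ {x y} → x ≢ r → y ≢ r → ¬ UsedOnLeg (parentColour x) (legIndex y) → Separates x y
  parentClass-separates {x} {y} x≢r y≢r unused =
    separatedByUnused (parentClass x) (distToClass-incident x~parent) y≢r
      (subst (λ k → ¬ UsedOnLeg k (legIndex y)) (sym toℕ-parentClass) unused)
    where
      x~parent = Adj-sym (parent-Adj x≢r)
      toℕ-parentClass : toℕ (parentClass x) ≡ parentColour x
      toℕ-parentClass = trans (toℕ-colour x~parent) (cong parentColour (deeperEnd-parent (depth-parent x≢r)))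

  differentLegs-separated : ∀ {x y} → x ≢ r → y ≢ r → depth x ≡ depth y → legIndex x ≢ legIndex y →
                            Dec (UsedOnLeg (parentColour x) (legIndex y)) → Dec (UsedOnLeg (parentColour y) (legIndex x)) →
                            Separates x y
  differentLegs-separated x≢r y≢r _ _ (no unused) _ = parentClass-separates x≢r y≢r unused
  differentLegs-separated x≢r y≢r _ _ (yes _) (no unused) = Separates-sym (parentClass-separates y≢r x≢r unused)
  differentLegs-separated {x} {y} x≢r y≢r d≡ differ (yes used) (yes used′) =
    ⊥-elim (crossed-colours-impossible (legIndex<m x≢r) (legIndex<m y≢r) differ (depth x) used
              (subst (λ j → UsedOnLeg (alternating (legIndex y) (next (legIndex y)) j) (legIndex x)) (sym d≡) used′))

  sameDepth-separated : ∀ {x y} → x ≢ r → y ≢ r → depth x ≡ depth y → x ≢ y → Separates x y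
  sameDepth-separated {x} {y} x≢r y≢r d≡ x≢y = byLeg (legIndex x ≟ legIndex y)
    where
      byLeg : Dec (legIndex x ≡ legIndex y) → Separates x y
      byLeg (yes same) = ⊥-elim (x≢y (sameDepth-sameLeg⇒≡ _ (proj₂ (≢root⇒depth≡suc x≢r))
                                                      (trans (sym d≡) (proj₂ (≢root⇒depth≡suc x≢r)))
                                       (position-injective (legOf∈legs x≢r) (legOf∈legs y≢r) same)))
      byLeg (no differ) = differentLegs-separated x≢r y≢r d≡ differ (UsedOnLeg? _ _) (UsedOnLeg? _ _)

  colouring-locating : IsEdgeLocating G colouring
  colouring-locating x y x≢y = byRoot (x FP.≟ r) (y FP.≟ r)
    where
      byDepth : x ≢ r → y ≢ r → Tri (depth x < depth y) (depth x ≡ depth y) (depth y < depth x) → Separates x y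
      byDepth x≢r y≢r (tri< d< _ _) = Separates-sym (shallower-separated y≢r d<)
      byDepth x≢r y≢r (tri≈ _ d≡ _) = sameDepth-separated x≢r y≢r d≡ x≢y
      byDepth x≢r y≢r (tri> _ _ d>) = shallower-separated x≢r d>
      byRoot : Dec (x ≡ r) → Dec (y ≡ r) → Separates x y
      byRoot (yes x≡r) (yes y≡r) = ⊥-elim (x≢y (trans x≡r (sym y≡r)))
      byRoot (yes refl) (no y≢r) = root-separated y≢r
      byRoot (no x≢r) (yes refl) = Separates-sym (root-separated x≢r)
      byRoot (no x≢r) (no y≢r) = byDepth x≢r y≢r (<-cmp (depth x) (depth y))

  χ′L≡m : ChiL≡ G m
  χ′L≡m = (colouring , colouring-locating) , λ k k<m (c , _) → <⇒≱ k<m (subst (_≤ k) deg-r (deg≤colours c r))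

theorem23 : (T : Graph) → IsTree T → 3 ≤ numLeaves T →
    (Δ T ≡ numLeaves T → ChiL≡ T (numLeaves T))
    × (Δ T < numLeaves T → ChiL≤ T (ΔInner T + numLeaves T))
theorem23 T (conn , acyc) three = spider , λ _ → innerBound
  where
    open Leaves T
    inner = innerVertex conn three
    spider : Δ T ≡ numLeaves T → ChiL≡ T (numLeaves T)
    spider Δ≡m with maxList-attained (deg T) (∈-allFin (proj₁ inner))
    ... | r , _ , deg-r≡Δ = Spider.χ′L≡m T conn acyc three r (trans deg-r≡Δ Δ≡m)
    innerBound : ChiL≤ T (ΔInner T + numLeaves T)
    innerBound with maxList-attained (degInner T) (¬IsLeaf⇒∈nonLeaves (proj₂ inner))
    ... | r , r∈ , degInner-r≡Δ′ = UpperBound.χ′L≤ T conn acyc three r (∈nonLeaves⇒¬IsLeaf r∈) degInner-r≡Δ′
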